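{- Let $n,m$ be integers with $1\le m\le n-2$ and let $G$ be a simple graph on $n$ vertices with vertex $2$-partiteness $v_2(G)\le m$. (1) If $n-m$ is even, then $M_1(G)\le m(n-1)^2+\frac{n^3+n^2m-m^2n-m^3}{4}$, $M_2(G)\le \frac{m(m-1)(n-1)^2}{2}+\frac{(n^2-m^2)(n^2+8mn-m^2-8m)}{16}$, $\Pi_1(G)\le (n-1)^{2m}\left(\frac{n+m}{2}\right)^{2(n-m)}$, $\Pi_2(G)\le (n-1)^{m(n-1)}\left(\frac{n+m}{2}\right)^{\frac{n^2-m^2}{2}}$, with equality (in each) if and only if $G\cong K_m\vee\big(\overline{K_{(n-m)/2}}\vee\overline{K_{(n-m)/2}}\big)$. (2) If $n-m$ is odd, then $M_1(G)\le m(n-1)^2+\frac{n^3+n^2m-m^2n-n-m^3-3m}{4}$, $M_2(G)\le \frac{m(m-1)(n-1)^2}{2}+\frac{((n+m)^2-1)((n-m)^2-1)+4m(n-1)(2n^2-2m^2-2)}{16}$, $\Pi_1(G)\le (n-1)^{2m}\left(\frac{n+m+1}{2}\right)^{n-m-1}\left(\frac{n+m-1}{2}\right)^{n-m+1}$, $\Pi_2(G)\le (n-1)^{m(n-1)}\left(\frac{n+m-1}{2}\right)^{\frac{n^2-m^2+2m-1}{4}}\left(\frac{n+m+1}{2}\right)^{\frac{n^2-m^2-2m-1}{4}}$, with equality (in each) if and only if $G\cong K_m\vee\big(\overline{K_{(n-m+1)/2}}\vee\overline{K_{(n-m-1)/2}}\big)$.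
   Context: The vertex $2$-partiteness $v_2(G)$ is the minimum number of vertices whose deletion from $G$ yields a bipartite graph (parts possibly empty). With $d(x)$ the degree of $x$: $M_1(G)=\sum_{x\in V(G)}d(x)^2$, $M_2(G)=\sum_{xy\in E(G)}d(x)d(y)$, $\Pi_1(G)=\prod_{x\in V(G)}d(x)^2$, $\Pi_2(G)=\prod_{xy\in E(G)}d(x)d(y)=\prod_{x\in V(G)}d(x)^{d(x)}$. $G_1\vee G_2$ is the join (disjoint union plus all edges between the two vertex sets); $\overline{K_r}$ is the edgeless graph on $r$ vertices; $K_m$ the complete graph. -}

module Defs where

open import Data.Nat using (ℕ; zero; suc; _+_; _*_; _∸_; _^_; _≤_; _<ᵇ_)
open import Data.Bool using (Bool; true; false; if_then_else_; _∧_; _∨_; not)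
open import Data.Fin using (Fin; toℕ; _≟_)
open import Data.Fin.Subset using (Subset; _∉_; ∣_∣)
open import Data.Product using (Σ; ∃; _×_; _,_)
open import Relation.Nullary using (¬_; does)
open import Relation.Binary.PropositionalEquality using (_≡_; _≢_)
open import Function.Bundles using (_↔_; Inverse)

sumF : ∀ {n} → (Fin n → ℕ) → ℕ
sumF {zero} f = 0
sumF {suc n} f = f Fin.zero + sumF (λ i → f (Fin.suc i))

prodF : ∀ {n} → (Fin n → ℕ) → ℕ
prodF {zero} f = 1
prodF {suc n} f = f Fin.zero * prodF (λ i → f (Fin.suc i))

record Graph (n : ℕ) : Set where
  field
    adj    : Fin n → Fin n → Bool
    sym    : ∀ i j → adj i j ≡ adj j i
    irrefl : ∀ i → adj i i ≡ false
open Graph public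

module _ {n : ℕ} (G : Graph n) where
  deg : Fin n → ℕ
  deg i = sumF (λ j → if adj G i j then 1 else 0)

  -- indicator of the edge {i,j} counted once (i < j)
  isEdge< : Fin n → Fin n → Bool
  isEdge< i j = (toℕ i <ᵇ toℕ j) ∧ adj G i j

  M₁ : ℕ
  M₁ = sumF (λ i → deg i ^ 2)

  M₂ : ℕ
  M₂ = sumF (λ i → sumF (λ j → if isEdge< i j then deg i * deg j else 0))

  Π₁ : ℕ
  Π₁ = prodF (λ i → deg i ^ 2)

  Π₂ : ℕ
  Π₂ = prodF (λ i → prodF (λ j → if isEdge< i j then deg i * deg j else 1))

  -- v₂(G) ≤ m : some set S of at most m vertices whose deletion leaves a
  -- bipartite graph (a proper 2-colouring of the remaining vertices)
  v₂≤ : ℕ → Set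
  v₂≤ m = Σ (Subset n) λ S → ∣ S ∣ ≤ m ×
          Σ (Fin n → Bool) λ side →
            ∀ i j → i ∉ S → j ∉ S → adj G i j ≡ true → side i ≢ side j

_≅_ : ∀ {n} → Graph n → Graph n → Set
_≅_ {n} G H = Σ (Fin n ↔ Fin n) λ σ →
  ∀ i j → adj G i j ≡ adj H (Inverse.to σ i) (Inverse.to σ j)

-- K_m ∨ (K̄_a ∨ K̄_b) on Fin n, where b = n - m - a:
-- vertices with index < m form K_m (class 0), the next a vertices form
-- class 1, the remaining ones class 2; classes 1 and 2 are independent sets.
joinClass : ∀ {n} → ℕ → ℕ → Fin n → ℕ
joinClass m a i = if toℕ i <ᵇ m then 0 else (if toℕ i <ᵇ m + a then 1 else 2)

eqℕ : ℕ → ℕ → Bool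
eqℕ x y = does (Data.Nat._≟_ x y)

joinAdj : ∀ {n} → ℕ → ℕ → Fin n → Fin n → Bool
joinAdj m a i j =
  not (does (i ≟ j)) ∧
  (eqℕ (joinClass m a i) 0 ∨ eqℕ (joinClass m a j) 0 ∨
   not (eqℕ (joinClass m a i) (joinClass m a j)))


IsoTo : ∀ {n} → Graph n → (Fin n → Fin n → Bool) → Set
IsoTo {n} G h = Σ (Fin n ↔ Fin n) λ σ →
  ∀ i j → adj G i j ≡ h (Inverse.to σ i) (Inverse.to σ j)

module Submission where

-- Deleting a set S, |S| ≤ m,
-- leaves a properly 2-coloured graph on A ∪ B, so G is a spanning subgraph of
-- the class graph K_s ∨ (K̄_p ∨ K̄_q), s = |S|, p = |A|, q = |B|.  M₁, M₂, Π₁, Π₂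
-- grow when edges are added and on class graphs are explicit functions of
-- (s, p, q).  Two exchange inequalities (moving a vertex into the clique part
-- while s < m; balancing A and B) show these functions peak exactly at s = m,
-- {p, q} = {⌈(n-m)/2⌉, ⌊(n-m)/2⌋}.  Equality forces G to equal that class
-- graph (its minimum degree is ≥ 2), which is isomorphic to the stated join.

open import Defs hiding (sym)
open import Data.Nat using (ℕ; zero; suc; _+_; _*_; _∸_; _^_; _≤_; _<_; _/_; _%_; z≤n; s≤s; _<ᵇ_; NonZero; >-nonZero; _≤?_)
open import Data.Nat.Properties
open import Data.Nat.DivMod using (m≡m%n+[m/n]*n; m*n/n≡m)
open import Data.Nat.Tactic.RingSolver using (solve-∀)
import Data.Integer.Tactic.RingSolver as ℤSolver
open import Data.Integer as ℤ using (ℤ; +_)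
open import Data.Integer.Properties using (pos-+; pos-*; +-injective)
open import Data.Fin as F using (Fin; toℕ)
open import Data.Fin.Properties using (toℕ-injective)
open import Data.Fin.Permutation as Perm using (Permutation; _⟨$⟩ʳ_; _⟨$⟩ˡ_; _∘ₚ_; lift₀; transpose)
open import Data.Fin.Subset using (Subset; _∉_; ∣_∣)
open import Data.Vec using ([]; _∷_; lookup)
open import Data.Vec.Properties using ([]=⇒lookup)
open import Data.Product using (_×_; _,_; Σ; proj₁; proj₂)
open import Data.Sum using (_⊎_; inj₁; inj₂)
open import Data.Bool using (Bool; true; false; if_then_else_; _∧_; _∨_; not)
open import Data.Bool.Properties using (∧-zeroʳ)
open import Function using (_∘_)
open import Function.Bundles using (_⇔_; _↔_; Inverse; mk⇔; Equivalence)
open import Relation.Binary.PropositionalEquality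
open import Relation.Binary.Definitions using (tri<; tri≈; tri>)
open import Relation.Nullary using (¬_; does; yes; no)
open import Data.Empty using (⊥-elim)
import Algebra.Properties.CommutativeMonoid.Sum as CMSum

-- Finite sums and products over Fin n

sumF-cong : ∀ {n} {f g : Fin n → ℕ} → (∀ i → f i ≡ g i) → sumF f ≡ sumF g
sumF-cong {zero} e = refl
sumF-cong {suc n} e = cong₂ _+_ (e F.zero) (sumF-cong (e ∘ F.suc))

prodF-cong : ∀ {n} {f g : Fin n → ℕ} → (∀ i → f i ≡ g i) → prodF f ≡ prodF g
prodF-cong {zero} e = refl
prodF-cong {suc n} e = cong₂ _*_ (e F.zero) (prodF-cong (e ∘ F.suc))

sumF-mono : ∀ {n} {f g : Fin n → ℕ} → (∀ i → f i ≤ g i) → sumF f ≤ sumF g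
sumF-mono {zero} le = ≤-refl
sumF-mono {suc n} le = +-mono-≤ (le F.zero) (sumF-mono (le ∘ F.suc))

prodF-mono : ∀ {n} {f g : Fin n → ℕ} → (∀ i → f i ≤ g i) → prodF f ≤ prodF g
prodF-mono {zero} le = ≤-refl
prodF-mono {suc n} le = *-mono-≤ (le F.zero) (prodF-mono (le ∘ F.suc))

sumF-const : ∀ n c → sumF {n} (λ _ → c) ≡ n * c
sumF-const zero c = refl
sumF-const (suc n) c = cong (_+_ c) (sumF-const n c)

prodF-1 : ∀ n → prodF {n} (λ _ → 1) ≡ 1
prodF-1 zero = refl
prodF-1 (suc n) = trans (+-identityʳ _) (prodF-1 n)

sumF-+ : ∀ {n} (f g : Fin n → ℕ) → sumF (λ i → f i + g i) ≡ sumF f + sumF g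
sumF-+ {zero} f g = refl
sumF-+ {suc n} f g =
  trans (cong (_+_ (f F.zero + g F.zero)) (sumF-+ (f ∘ F.suc) (g ∘ F.suc)))
        (+-+-swap (f F.zero) (g F.zero) _ _)
  where
  +-+-swap : ∀ a b c d → (a + b) + (c + d) ≡ (a + c) + (b + d)
  +-+-swap = solve-∀

prodF-* : ∀ {n} (f g : Fin n → ℕ) → prodF (λ i → f i * g i) ≡ prodF f * prodF g
prodF-* {zero} f g = refl
prodF-* {suc n} f g =
  trans (cong (f F.zero * g F.zero *_) (prodF-* (f ∘ F.suc) (g ∘ F.suc)))
        (*-*-swap (f F.zero) (g F.zero) _ _)
  where
  *-*-swap : ∀ a b c d → (a * b) * (c * d) ≡ (a * c) * (b * d)
  *-*-swap = solve-∀

sumF-*ˡ : ∀ {n} c (f : Fin n → ℕ) → sumF (λ i → c * f i) ≡ c * sumF f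
sumF-*ˡ {zero} c f = sym (*-zeroʳ c)
sumF-*ˡ {suc n} c f = trans (cong (_+_ (c * f F.zero)) (sumF-*ˡ c (f ∘ F.suc)))
                            (sym (*-distribˡ-+ c (f F.zero) _))

sumF-swap : ∀ {m n} (f : Fin m → Fin n → ℕ) →
  sumF (λ i → sumF (f i)) ≡ sumF (λ j → sumF (λ i → f i j))
sumF-swap {zero} {n} f = sym (trans (sumF-const n 0) (*-zeroʳ n))
sumF-swap {suc m} f =
  trans (cong (_+_ (sumF (f F.zero))) (sumF-swap (f ∘ F.suc)))
        (sym (sumF-+ (f F.zero) (λ j → sumF (λ i → f (F.suc i) j))))

prodF-swap : ∀ {m n} (f : Fin m → Fin n → ℕ) →
  prodF (λ i → prodF (f i)) ≡ prodF (λ j → prodF (λ i → f i j))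
prodF-swap {zero} {n} f = sym (prodF-1 n)
prodF-swap {suc m} f =
  trans (cong (prodF (f F.zero) *_) (prodF-swap (f ∘ F.suc)))
        (sym (prodF-* (f F.zero) (λ j → prodF (λ i → f (F.suc i) j))))

-- Invariance under permutations, inherited from the library's big operators
-- for commutative monoids.
module ΣProperties = CMSum +-0-commutativeMonoid
module ΠProperties = CMSum *-1-commutativeMonoid

sumF≡sum : ∀ {n} (f : Fin n → ℕ) → sumF f ≡ ΣProperties.sum f
sumF≡sum {zero} f = refl
sumF≡sum {suc n} f = cong (_+_ (f F.zero)) (sumF≡sum (f ∘ F.suc))

prodF≡prod : ∀ {n} (f : Fin n → ℕ) → prodF f ≡ ΠProperties.sum f
prodF≡prod {zero} f = refl
prodF≡prod {suc n} f = cong (f F.zero *_) (prodF≡prod (f ∘ F.suc))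

sumF-perm : ∀ {n} (σ : Fin n ↔ Fin n) (f : Fin n → ℕ) → sumF (f ∘ Inverse.to σ) ≡ sumF f
sumF-perm σ f = begin
  sumF (f ∘ Inverse.to σ)          ≡⟨ sumF≡sum (f ∘ Inverse.to σ) ⟩
  ΣProperties.sum (f ∘ Inverse.to σ) ≡⟨ sym (ΣProperties.sum-permute f σ) ⟩
  ΣProperties.sum f                ≡⟨ sym (sumF≡sum f) ⟩
  sumF f                           ∎
  where open ≡-Reasoning

prodF-perm : ∀ {n} (σ : Fin n ↔ Fin n) (f : Fin n → ℕ) → prodF (f ∘ Inverse.to σ) ≡ prodF f
prodF-perm σ f = begin
  prodF (f ∘ Inverse.to σ)           ≡⟨ prodF≡prod (f ∘ Inverse.to σ) ⟩
  ΠProperties.sum (f ∘ Inverse.to σ) ≡⟨ sym (ΠProperties.sum-permute f σ) ⟩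
  ΠProperties.sum f                  ≡⟨ sym (prodF≡prod f) ⟩
  prodF f                            ∎
  where open ≡-Reasoning

term≤sumF : ∀ {n} (f : Fin n → ℕ) i → f i ≤ sumF f
term≤sumF f F.zero = m≤m+n _ _
term≤sumF f (F.suc i) = ≤-trans (term≤sumF (f ∘ F.suc) i) (m≤n+m _ _)

*-pos : ∀ {x y} → 0 < x → 0 < y → 0 < x * y
*-pos {suc x} {suc y} _ _ = s≤s z≤n

prodF-pos : ∀ {n} {f : Fin n → ℕ} → (∀ i → 0 < f i) → 0 < prodF f
prodF-pos {zero} pos = s≤s z≤n
prodF-pos {suc n} pos = *-pos (pos F.zero) (prodF-pos (pos ∘ F.suc))

+-≡-split : ∀ {a b c d} → a ≤ c → b ≤ d → a + b ≡ c + d → a ≡ c × b ≡ d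
+-≡-split {a} {b} {c} {d} a≤c b≤d e with m≤n⇒m<n∨m≡n a≤c
... | inj₂ a≡c = a≡c , +-cancelˡ-≡ c b d (trans (cong (_+ b) (sym a≡c)) e)
... | inj₁ a<c = ⊥-elim (<-irrefl e (+-mono-<-≤ a<c b≤d))

*-≡-split : ∀ {a b c d} → a ≤ c → b ≤ d → 0 < c * d → a * b ≡ c * d → a ≡ c × b ≡ d
*-≡-split {a} {b} {c} {d} a≤c b≤d cd>0 e = a≡c , b≡d
  where
  ad≡cd : a * d ≡ c * d
  ad≡cd = ≤-antisym (*-monoˡ-≤ d a≤c) (subst (_≤ a * d) e (*-monoʳ-≤ a b≤d))
  d>0 : 0 < d
  d>0 = n≢0⇒n>0 (λ { refl → <-irrefl (sym (*-zeroʳ c)) cd>0 })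
  a≡c : a ≡ c
  a≡c = *-cancelʳ-≡ a c d {{>-nonZero d>0}} ad≡cd
  a>0 : 0 < a
  a>0 = subst (0 <_) (sym a≡c) (n≢0⇒n>0 (λ { refl → <-irrefl refl cd>0 }))
  b≡d : b ≡ d
  b≡d = *-cancelˡ-≡ b d a {{>-nonZero a>0}} (trans e (sym ad≡cd))

sumF-≡⇒pointwise : ∀ {n} {f g : Fin n → ℕ} → (∀ i → f i ≤ g i) →
  sumF f ≡ sumF g → ∀ i → f i ≡ g i
sumF-≡⇒pointwise {suc n} le e i with +-≡-split (le F.zero) (sumF-mono (le ∘ F.suc)) e
sumF-≡⇒pointwise {suc n} le e F.zero    | e₀ , _ = e₀
sumF-≡⇒pointwise {suc n} le e (F.suc i) | _ , es = sumF-≡⇒pointwise (le ∘ F.suc) es i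

prodF-≡⇒pointwise : ∀ {n} {f g : Fin n → ℕ} → (∀ i → f i ≤ g i) → 0 < prodF g →
  prodF f ≡ prodF g → ∀ i → f i ≡ g i
prodF-≡⇒pointwise {suc n} {g = g} le pos e i
  with *-≡-split (le F.zero) (prodF-mono (le ∘ F.suc)) pos e
prodF-≡⇒pointwise {suc n} le pos e F.zero    | e₀ , _ = e₀
prodF-≡⇒pointwise {suc n} {g = g} le pos e (F.suc i) | _ , es =
  prodF-≡⇒pointwise (le ∘ F.suc) (*-pos-right (g F.zero) pos) es i
  where
  *-pos-right : ∀ x {y} → 0 < x * y → 0 < y
  *-pos-right x {zero} p = ⊥-elim (<-irrefl (sym (*-zeroʳ x)) p)
  *-pos-right x {suc y} p = s≤s z≤n

-- Edge sums and edge products as vertex sums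
--
-- M₂ and Π₂ run over ordered pairs i < j.  Adding the mirrored term turns
-- them into sums/products over all adjacent pairs, which factor vertexwise:
--   2·M₂ = Σᵢ d(i)·Σ_{j~i} d(j)        and        Π₂ = Πᵢ d(i)^d(i).

<ᵇ-true : ∀ {a b} → a < b → (a <ᵇ b) ≡ true
<ᵇ-true {zero} {suc b} _ = refl
<ᵇ-true {suc a} {suc b} (s≤s a<b) = <ᵇ-true a<b

<ᵇ-false : ∀ {a b} → b ≤ a → (a <ᵇ b) ≡ false
<ᵇ-false {zero} {zero} _ = refl
<ᵇ-false {suc a} {zero} _ = refl
<ᵇ-false {suc a} {suc b} (s≤s b≤a) = <ᵇ-false b≤a

square-injective : ∀ {x y} → x * x ≡ y * y → x ≡ y
square-injective {x} {y} e with <-cmp x y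
... | tri≈ _ x≡y _ = x≡y
... | tri< x<y _ _ = ⊥-elim (<-irrefl e (*-mono-< x<y x<y))
... | tri> _ _ y<x = ⊥-elim (<-irrefl (sym e) (*-mono-< y<x y<x))

module EdgeSums {n} (G : Graph n) (w : Fin n → ℕ) where

  pair-sum : ∀ i j → (if isEdge< G i j then w i * w j else 0) + (if isEdge< G j i then w j * w i else 0)
                   ≡ (if adj G i j then w i * w j else 0)
  pair-sum i j with <-cmp (toℕ i) (toℕ j)
  ... | tri< lt _ _ rewrite <ᵇ-true lt | <ᵇ-false (<⇒≤ lt) = +-identityʳ _
  ... | tri> _ _ gt rewrite <ᵇ-false (<⇒≤ gt) | <ᵇ-true gt | Graph.sym G j i | *-comm (w j) (w i) = refl
  ... | tri≈ _ eq _ with toℕ-injective eq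
  ...   | refl rewrite irrefl G i | ∧-zeroʳ (toℕ i <ᵇ toℕ i) = refl

  pair-prod : ∀ i j → (if isEdge< G i j then w i * w j else 1) * (if isEdge< G j i then w j * w i else 1)
                    ≡ (if adj G i j then w i * w j else 1)
  pair-prod i j with <-cmp (toℕ i) (toℕ j)
  ... | tri< lt _ _ rewrite <ᵇ-true lt | <ᵇ-false (<⇒≤ lt) = *-identityʳ _
  ... | tri> _ _ gt rewrite <ᵇ-false (<⇒≤ gt) | <ᵇ-true gt | Graph.sym G j i | *-comm (w j) (w i) = +-identityʳ _
  ... | tri≈ _ eq _ with toℕ-injective eq
  ...   | refl rewrite irrefl G i | ∧-zeroʳ (toℕ i <ᵇ toℕ i) = refl

  edge-term : Fin n → Fin n → ℕ
  edge-term i j = if isEdge< G i j then w i * w j else 0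

  edge-factor : Fin n → Fin n → ℕ
  edge-factor i j = if isEdge< G i j then w i * w j else 1

  prod-over-nbrs : ∀ {m} (b : Fin m → Bool) c →
    prodF (λ j → if b j then c else 1) ≡ c ^ sumF (λ j → if b j then 1 else 0)
  prod-over-nbrs {zero} b c = refl
  prod-over-nbrs {suc m} b c with b F.zero
  ... | true = cong (c *_) (prod-over-nbrs (b ∘ F.suc) c)
  ... | false = trans (+-identityʳ _) (prod-over-nbrs (b ∘ F.suc) c)

  twice-edge-sum : 2 * sumF (λ i → sumF (edge-term i))
                 ≡ sumF (λ i → w i * sumF (λ j → if adj G i j then w j else 0))
  twice-edge-sum = begin
    2 * S                                                    ≡⟨ cong (_+_ S) (+-identityʳ S) ⟩
    S + S                                                    ≡⟨ cong (_+_ S) (sumF-swap edge-term) ⟩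
    S + sumF (λ i → sumF (λ j → edge-term j i))              ≡⟨ sym (sumF-+ (λ i → sumF (edge-term i)) _) ⟩
    sumF (λ i → sumF (edge-term i) + sumF (λ j → edge-term j i))
      ≡⟨ sumF-cong (λ i → sym (sumF-+ (edge-term i) (λ j → edge-term j i))) ⟩
    sumF (λ i → sumF (λ j → edge-term i j + edge-term j i))  ≡⟨ sumF-cong (λ i → sumF-cong (pair-sum i)) ⟩
    sumF (λ i → sumF (λ j → if adj G i j then w i * w j else 0))
      ≡⟨ sumF-cong (λ i → trans (sumF-cong (λ j → pull-out i j (adj G i j))) (sumF-*ˡ (w i) (λ j → if adj G i j then w j else 0))) ⟩
    sumF (λ i → w i * sumF (λ j → if adj G i j then w j else 0)) ∎
    where
    open ≡-Reasoning
    S : ℕ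
    S = sumF (λ i → sumF (edge-term i))
    pull-out : ∀ i j b → (if b then w i * w j else 0) ≡ w i * (if b then w j else 0)
    pull-out i j false = sym (*-zeroʳ (w i))
    pull-out i j true = refl

  edge-prod : ℕ
  edge-prod = prodF (λ i → prodF (edge-factor i))

  vertex-prod : ℕ
  vertex-prod = prodF (λ i → w i ^ deg G i)

  squared-edge-prod : edge-prod * edge-prod ≡ vertex-prod * vertex-prod
  squared-edge-prod = begin
    P * P                                                      ≡⟨ cong (P *_) (prodF-swap edge-factor) ⟩
    P * prodF (λ i → prodF (λ j → edge-factor j i))            ≡⟨ sym (prodF-* (λ i → prodF (edge-factor i)) _) ⟩
    prodF (λ i → prodF (edge-factor i) * prodF (λ j → edge-factor j i))
      ≡⟨ prodF-cong (λ i → sym (prodF-* (edge-factor i) (λ j → edge-factor j i))) ⟩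
    prodF (λ i → prodF (λ j → edge-factor i j * edge-factor j i)) ≡⟨ prodF-cong (λ i → prodF-cong (pair-prod i)) ⟩
    prodF (λ i → prodF (λ j → if adj G i j then w i * w j else 1))
      ≡⟨ prodF-cong (λ i → trans (prodF-cong (λ j → split i j (adj G i j))) (prodF-* (λ j → if adj G i j then w i else 1) (λ j → if adj G i j then w j else 1))) ⟩
    prodF (λ i → prodF (λ j → if adj G i j then w i else 1) * prodF (λ j → if adj G i j then w j else 1))
      ≡⟨ prodF-* (λ i → prodF (λ j → if adj G i j then w i else 1)) _ ⟩
    prodF (λ i → prodF (λ j → if adj G i j then w i else 1)) * prodF (λ i → prodF (λ j → if adj G i j then w j else 1))
      ≡⟨ cong₂ _*_ (prodF-cong (λ i → prod-over-nbrs (adj G i) (w i))) (prodF-swap (λ i j → if adj G i j then w j else 1)) ⟩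
    X * prodF (λ j → prodF (λ i → if adj G i j then w j else 1))
      ≡⟨ cong (X *_) (prodF-cong (λ j → trans (prodF-cong (λ i → cong (λ b → if b then w j else 1) (Graph.sym G i j)))
                                               (prod-over-nbrs (adj G j) (w j)))) ⟩
    X * X ∎
    where
    open ≡-Reasoning
    split : ∀ i j b → (if b then w i * w j else 1) ≡ (if b then w i else 1) * (if b then w j else 1)
    split i j false = refl
    split i j true = refl
    P : ℕ
    P = edge-prod
    X : ℕ
    X = vertex-prod

M₂-by-vertices : ∀ {n} (G : Graph n) → 2 * M₂ G ≡ sumF (λ i → deg G i * sumF (λ j → if adj G i j then deg G j else 0))
M₂-by-vertices G = EdgeSums.twice-edge-sum G (deg G)

Π₂-by-vertices : ∀ {n} (G : Graph n) → Π₂ G ≡ prodF (λ i → deg G i ^ deg G i)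
Π₂-by-vertices G = square-injective (EdgeSums.squared-edge-prod G (deg G))

-- Spanning subgraphs
--
-- If every edge of G is an edge of H (same vertex set), every degree and
-- hence each of the four indices can only grow from G to H.  Conversely,
-- equality of an index forces G = H; for Π₁ and Π₂ this needs H to have
-- minimum degree ≥ 2, since otherwise factors 1 carry no information.

ind : Bool → ℕ
ind b = if b then 1 else 0

ind-injective : ∀ {a b} → ind a ≡ ind b → a ≡ b
ind-injective {false} {false} _ = refl
ind-injective {true} {true} _ = refl

false≢true : false ≢ true
false≢true ()

_⊆ᴳ_ : ∀ {n} → Graph n → Graph n → Set
G ⊆ᴳ H = ∀ i j → adj G i j ≡ true → adj H i j ≡ true

SameEdges : ∀ {n} → Graph n → Graph n → Set
SameEdges G H = ∀ i j → adj G i j ≡ adj H i j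

adj⇒deg≥1 : ∀ {n} (H : Graph n) i j → adj H i j ≡ true → 1 ≤ deg H i
adj⇒deg≥1 H i j e = subst (λ b → ind b ≤ deg H i) e (term≤sumF (ind ∘ adj H i) j)

2≤* : ∀ {x y} → 2 ≤ x → 2 ≤ y → 2 ≤ x * y
2≤* {suc x} {y} _ 2≤y = ≤-trans 2≤y (m≤m+n y (x * y))

guarded-mono₀ : ∀ (l g h : Bool) {x y} → (g ≡ true → h ≡ true) → x ≤ y →
  (if l ∧ g then x else 0) ≤ (if l ∧ h then y else 0)
guarded-mono₀ false g h g⇒h x≤y = ≤-refl
guarded-mono₀ true false h g⇒h x≤y = z≤n
guarded-mono₀ true true h g⇒h x≤y rewrite g⇒h refl = x≤y

guarded-mono₁ : ∀ (l g h : Bool) {x y} → (g ≡ true → h ≡ true) → x ≤ y → (h ≡ true → 1 ≤ y) →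
  (if l ∧ g then x else 1) ≤ (if l ∧ h then y else 1)
guarded-mono₁ false g h g⇒h x≤y y≥1 = ≤-refl
guarded-mono₁ true false false g⇒h x≤y y≥1 = ≤-refl
guarded-mono₁ true false true g⇒h x≤y y≥1 = y≥1 refl
guarded-mono₁ true true h g⇒h x≤y y≥1 rewrite g⇒h refl = x≤y

guarded-eq₀ : ∀ (l g h : Bool) {x y} → (if l ∧ g then x else 0) ≡ (if l ∧ h then y else 0) →
  1 ≤ y → l ≡ true → h ≡ true → g ≡ true
guarded-eq₀ true true h e y≥1 _ _ = refl
guarded-eq₀ true false true e y≥1 _ _ = ⊥-elim (<-irrefl e y≥1)

guarded-eq₁ : ∀ (l g h : Bool) {x y} → (if l ∧ g then x else 1) ≡ (if l ∧ h then y else 1) →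
  2 ≤ y → l ≡ true → h ≡ true → g ≡ true
guarded-eq₁ true true h e y≥2 _ _ = refl
guarded-eq₁ true false true e y≥2 _ _ = ⊥-elim (<-irrefl e y≥2)

module Spanning {n} (G H : Graph n) (G⊆H : G ⊆ᴳ H) where

  ind-mono : ∀ i j → ind (adj G i j) ≤ ind (adj H i j)
  ind-mono i j with adj G i j in e
  ... | false = z≤n
  ... | true rewrite G⊆H i j e = ≤-refl

  deg-mono : ∀ i → deg G i ≤ deg H i
  deg-mono i = sumF-mono (ind-mono i)

  degree-product≥1 : ∀ i j → adj H i j ≡ true → 1 ≤ deg H i * deg H j
  degree-product≥1 i j e =
    *-mono-≤ {1} {_} {1} (adj⇒deg≥1 H i j e) (adj⇒deg≥1 H j i (trans (Graph.sym H j i) e))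

  M₂-term-mono : ∀ i j → (if isEdge< G i j then deg G i * deg G j else 0)
                       ≤ (if isEdge< H i j then deg H i * deg H j else 0)
  M₂-term-mono i j = guarded-mono₀ (toℕ i <ᵇ toℕ j) (adj G i j) (adj H i j) (G⊆H i j)
                       (*-mono-≤ (deg-mono i) (deg-mono j))

  Π₂-factor-mono : ∀ i j → (if isEdge< G i j then deg G i * deg G j else 1)
                         ≤ (if isEdge< H i j then deg H i * deg H j else 1)
  Π₂-factor-mono i j = guarded-mono₁ (toℕ i <ᵇ toℕ j) (adj G i j) (adj H i j) (G⊆H i j)
                         (*-mono-≤ (deg-mono i) (deg-mono j)) (degree-product≥1 i j)

  M₁-mono : M₁ G ≤ M₁ H
  M₁-mono = sumF-mono (λ i → ^-monoˡ-≤ 2 (deg-mono i))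

  M₂-mono : M₂ G ≤ M₂ H
  M₂-mono = sumF-mono (λ i → sumF-mono (M₂-term-mono i))

  Π₁-mono : Π₁ G ≤ Π₁ H
  Π₁-mono = prodF-mono (λ i → ^-monoˡ-≤ 2 (deg-mono i))

  Π₂-mono : Π₂ G ≤ Π₂ H
  Π₂-mono = prodF-mono (λ i → prodF-mono (Π₂-factor-mono i))

  same-degrees⇒same-edges : (∀ i → deg G i ≡ deg H i) → SameEdges G H
  same-degrees⇒same-edges e i j = ind-injective (sumF-≡⇒pointwise (ind-mono i) (e i) j)

  upper-edges⇒same-edges : (∀ i j → toℕ i < toℕ j → adj H i j ≡ true → adj G i j ≡ true) → SameEdges G H
  upper-edges⇒same-edges up i j with adj H i j in eH | adj G i j in eG
  ... | true  | true  = refl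
  ... | false | false = refl
  ... | false | true  = ⊥-elim (false≢true (trans (sym eH) (G⊆H i j eG)))
  ... | true  | false = ⊥-elim (false≢true (trans (sym eG) H⇒G))
    where
    H⇒G : adj G i j ≡ true
    H⇒G with <-cmp (toℕ i) (toℕ j)
    ... | tri< lt _ _ = up i j lt eH
    ... | tri> _ _ gt = trans (Graph.sym G i j) (up j i gt (trans (Graph.sym H j i) eH))
    ... | tri≈ _ eq _ with toℕ-injective eq
    ...   | refl = ⊥-elim (false≢true (trans (sym (irrefl H i)) eH))

  M₁-rigid : M₁ G ≡ M₁ H → SameEdges G H
  M₁-rigid e = same-degrees⇒same-edges λ i → square-injective (begin
    deg G i * deg G i ≡⟨ cong (deg G i *_) (sym (*-identityʳ (deg G i))) ⟩
    deg G i ^ 2       ≡⟨ sumF-≡⇒pointwise (λ i → ^-monoˡ-≤ 2 (deg-mono i)) e i ⟩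
    deg H i ^ 2       ≡⟨ cong (deg H i *_) (*-identityʳ (deg H i)) ⟩
    deg H i * deg H i ∎)
    where open ≡-Reasoning

  M₂-rigid : M₂ G ≡ M₂ H → SameEdges G H
  M₂-rigid e = upper-edges⇒same-edges λ i j i<j eH →
    guarded-eq₀ (toℕ i <ᵇ toℕ j) (adj G i j) (adj H i j)
      (sumF-≡⇒pointwise (M₂-term-mono i) (sumF-≡⇒pointwise (λ i → sumF-mono (M₂-term-mono i)) e i) j)
      (degree-product≥1 i j eH) (<ᵇ-true i<j) eH

  module _ (mindeg≥2 : ∀ i → 2 ≤ deg H i) where

    deg>0 : ∀ i → 0 < deg H i
    deg>0 i = ≤-trans (s≤s z≤n) (mindeg≥2 i)

    Π₁-rigid : Π₁ G ≡ Π₁ H → SameEdges G H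
    Π₁-rigid e = same-degrees⇒same-edges λ i → square-injective (begin
      deg G i * deg G i ≡⟨ cong (deg G i *_) (sym (*-identityʳ (deg G i))) ⟩
      deg G i ^ 2       ≡⟨ prodF-≡⇒pointwise (λ i → ^-monoˡ-≤ 2 (deg-mono i)) Π₁H>0 e i ⟩
      deg H i ^ 2       ≡⟨ cong (deg H i *_) (*-identityʳ (deg H i)) ⟩
      deg H i * deg H i ∎)
      where
      open ≡-Reasoning
      Π₁H>0 : 0 < Π₁ H
      Π₁H>0 = prodF-pos (λ i → *-pos (deg>0 i) (*-pos (deg>0 i) (s≤s z≤n)))

    Π₂-rigid : Π₂ G ≡ Π₂ H → SameEdges G H
    Π₂-rigid e = upper-edges⇒same-edges λ i j i<j eH →
      guarded-eq₁ (toℕ i <ᵇ toℕ j) (adj G i j) (adj H i j)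
        (prodF-≡⇒pointwise (Π₂-factor-mono i) (row>0 i)
          (prodF-≡⇒pointwise (λ i → prodF-mono (Π₂-factor-mono i)) (prodF-pos row>0) e i) j)
        (2≤* (mindeg≥2 i) (mindeg≥2 j)) (<ᵇ-true i<j) eH
      where
      factor>0 : ∀ i j → 0 < (if isEdge< H i j then deg H i * deg H j else 1)
      factor>0 i j with isEdge< H i j
      ... | false = s≤s z≤n
      ... | true = *-pos (deg>0 i) (deg>0 j)
      row>0 : ∀ i → 0 < prodF (λ j → if isEdge< H i j then deg H i * deg H j else 1)
      row>0 i = prodF-pos (factor>0 i)

-- Three-class graphs
--
-- A map κ : Fin n → Cls sorts the vertices into a class K and two classes
-- A, B.  The class graph of κ joins two distinct vertices unless both lie
-- in A or both lie in B, so it is K_s ∨ (K̄_p ∨ K̄_q) for the class sizes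
-- s, p, q.

data Cls : Set where
  Kc Ac Bc : Cls

link : Cls → Cls → Bool
link Ac Ac = false
link Bc Bc = false
link _  _  = true

link-sym : ∀ c d → link c d ≡ link d c
link-sym Kc Kc = refl
link-sym Kc Ac = refl
link-sym Kc Bc = refl
link-sym Ac Kc = refl
link-sym Ac Ac = refl
link-sym Ac Bc = refl
link-sym Bc Kc = refl
link-sym Bc Ac = refl
link-sym Bc Bc = refl

_=ᶜ_ : Cls → Cls → Bool
Kc =ᶜ Kc = true
Ac =ᶜ Ac = true
Bc =ᶜ Bc = true
_  =ᶜ _  = false

=ᶜ-refl : ∀ c → (c =ᶜ c) ≡ true
=ᶜ-refl Kc = refl
=ᶜ-refl Ac = refl
=ᶜ-refl Bc = refl

≟-sym : ∀ {n} (i j : Fin n) → does (i F.≟ j) ≡ does (j F.≟ i)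
≟-sym F.zero F.zero = refl
≟-sym F.zero (F.suc j) = refl
≟-sym (F.suc i) F.zero = refl
≟-sym (F.suc i) (F.suc j) = ≟-sym i j

≟-refl : ∀ {n} (i : Fin n) → does (i F.≟ i) ≡ true
≟-refl F.zero = refl
≟-refl (F.suc i) = ≟-refl i

classAdj : ∀ {n} → (Fin n → Cls) → Fin n → Fin n → Bool
classAdj κ i j = not (does (i F.≟ j)) ∧ link (κ i) (κ j)

classGraph : ∀ {n} → (Fin n → Cls) → Graph n
classGraph κ = record { adj = classAdj κ ; sym = symmetric ; irrefl = irreflexive }
  where
  symmetric : ∀ i j → classAdj κ i j ≡ classAdj κ j i
  symmetric i j rewrite ≟-sym i j | link-sym (κ i) (κ j) = refl
  irreflexive : ∀ i → classAdj κ i i ≡ false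
  irreflexive i rewrite ≟-refl i = refl

cnt : ∀ {n} → (Fin n → Cls) → Cls → ℕ
cnt κ c = sumF (λ i → ind (κ i =ᶜ c))

cnt-self : ∀ {n} (κ : Fin n → Cls) i → 1 ≤ cnt κ (κ i)
cnt-self κ i = subst (λ b → ind b ≤ cnt κ (κ i)) (=ᶜ-refl (κ i)) (term≤sumF (λ j → ind (κ j =ᶜ κ i)) i)

class-sum : ∀ {n} (κ : Fin n → Cls) (f : Cls → ℕ) →
  sumF (f ∘ κ) ≡ cnt κ Kc * f Kc + cnt κ Ac * f Ac + cnt κ Bc * f Bc
class-sum {zero} κ f = refl
class-sum {suc n} κ f =
  trans (cong (_+_ (f (κ F.zero))) (class-sum (κ ∘ F.suc) f)) (step (κ F.zero) f _ _ _)
  where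
  step : ∀ c (f : Cls → ℕ) sK sA sB → f c + (sK * f Kc + sA * f Ac + sB * f Bc)
    ≡ (ind (c =ᶜ Kc) + sK) * f Kc + (ind (c =ᶜ Ac) + sA) * f Ac + (ind (c =ᶜ Bc) + sB) * f Bc
  step Kc f sK sA sB = lemma (f Kc) (f Ac) (f Bc) sK sA sB
    where
    lemma : ∀ fK fA fB sK sA sB → fK + (sK * fK + sA * fA + sB * fB) ≡ (1 + sK) * fK + (0 + sA) * fA + (0 + sB) * fB
    lemma = solve-∀
  step Ac f sK sA sB = lemma (f Kc) (f Ac) (f Bc) sK sA sB
    where
    lemma : ∀ fK fA fB sK sA sB → fA + (sK * fK + sA * fA + sB * fB) ≡ (0 + sK) * fK + (1 + sA) * fA + (0 + sB) * fB
    lemma = solve-∀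
  step Bc f sK sA sB = lemma (f Kc) (f Ac) (f Bc) sK sA sB
    where
    lemma : ∀ fK fA fB sK sA sB → fB + (sK * fK + sA * fA + sB * fB) ≡ (0 + sK) * fK + (0 + sA) * fA + (1 + sB) * fB
    lemma = solve-∀

class-prod : ∀ {n} (κ : Fin n → Cls) (f : Cls → ℕ) →
  prodF (f ∘ κ) ≡ f Kc ^ cnt κ Kc * f Ac ^ cnt κ Ac * f Bc ^ cnt κ Bc
class-prod {zero} κ f = refl
class-prod {suc n} κ f =
  trans (cong (f (κ F.zero) *_) (class-prod (κ ∘ F.suc) f)) (step (κ F.zero) f _ _ _)
  where
  step : ∀ c (f : Cls → ℕ) sK sA sB → f c * (f Kc ^ sK * f Ac ^ sA * f Bc ^ sB)
    ≡ f Kc ^ (ind (c =ᶜ Kc) + sK) * f Ac ^ (ind (c =ᶜ Ac) + sA) * f Bc ^ (ind (c =ᶜ Bc) + sB)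
  step Kc f sK sA sB = lemma (f Kc) (f Kc ^ sK) (f Ac ^ sA) (f Bc ^ sB)
    where
    lemma : ∀ x X Y Z → x * (X * Y * Z) ≡ x * X * Y * Z
    lemma = solve-∀
  step Ac f sK sA sB = lemma (f Ac) (f Kc ^ sK) (f Ac ^ sA) (f Bc ^ sB)
    where
    lemma : ∀ x X Y Z → x * (X * Y * Z) ≡ X * (x * Y) * Z
    lemma = solve-∀
  step Bc f sK sA sB = lemma (f Bc) (f Kc ^ sK) (f Ac ^ sA) (f Bc ^ sB)
    where
    lemma : ∀ x X Y Z → x * (X * Y * Z) ≡ X * Y * (x * Z)
    lemma = solve-∀

cnt-total : ∀ {n} (κ : Fin n → Cls) → cnt κ Kc + cnt κ Ac + cnt κ Bc ≡ n
cnt-total {n} κ = begin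
  cnt κ Kc + cnt κ Ac + cnt κ Bc             ≡⟨ sym (by-one (cnt κ Kc) (cnt κ Ac) (cnt κ Bc)) ⟩
  cnt κ Kc * 1 + cnt κ Ac * 1 + cnt κ Bc * 1 ≡⟨ sym (class-sum κ (λ _ → 1)) ⟩
  sumF {n} (λ _ → 1)                         ≡⟨ trans (sumF-const n 1) (*-identityʳ n) ⟩
  n                                          ∎
  where
  open ≡-Reasoning
  by-one : ∀ a b c → a * 1 + b * 1 + c * 1 ≡ a + b + c
  by-one = solve-∀

sumF-off-diagonal : ∀ {n} (i : Fin n) (h : Fin n → ℕ) →
  sumF (λ j → if does (i F.≟ j) then 0 else h j) + h i ≡ sumF h
sumF-off-diagonal {suc n} F.zero h = +-comm (sumF (h ∘ F.suc)) (h F.zero)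
sumF-off-diagonal {suc n} (F.suc i) h =
  trans (+-assoc (h F.zero) _ (h (F.suc i))) (cong (_+_ (h F.zero)) (sumF-off-diagonal i (h ∘ F.suc)))

-- the sum of a class function over the neighbours of i, completed by the
-- (fictitious) loop term at i, groups into the classes linked to κ i
nbr-class-sum : ∀ {n} (κ : Fin n → Cls) (i : Fin n) (g : Cls → ℕ) →
  sumF (λ j → if classAdj κ i j then g (κ j) else 0) + (if link (κ i) (κ i) then g (κ i) else 0)
  ≡ cnt κ Kc * (if link (κ i) Kc then g Kc else 0) + cnt κ Ac * (if link (κ i) Ac then g Ac else 0)
    + cnt κ Bc * (if link (κ i) Bc then g Bc else 0)
nbr-class-sum κ i g =
  trans (cong (_+ (if link (κ i) (κ i) then g (κ i) else 0))
          (sumF-cong (λ j → guard-split (does (i F.≟ j)) (link (κ i) (κ j)) (g (κ j)))))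
  (trans (sumF-off-diagonal i (λ j → if link (κ i) (κ j) then g (κ j) else 0))
         (class-sum κ (λ c → if link (κ i) c then g c else 0)))
  where
  guard-split : ∀ (d l : Bool) (x : ℕ) → (if (not d ∧ l) then x else 0) ≡ (if d then 0 else (if l then x else 0))
  guard-split false l x = refl
  guard-split true l x = refl

-- Degree data of K_s ∨ (K̄_p ∨ K̄_q) on k+1 vertices, over any carrier with
-- + and ×; s⁻ stands for s - 1.  It is used over ℕ and, for the closed
-- forms, over expressions that evaluate both in ℕ and in ℤ.
module DegreePolynomials {A : Set} (_⊕_ _⊗_ : A → A → A) (k s s⁻ p q : A) where

  degree : Cls → A
  degree Kc = k
  degree Ac = s ⊕ q
  degree Bc = s ⊕ p

  nbr-degree-sum : Cls → A
  nbr-degree-sum Kc = ((s⁻ ⊗ k) ⊕ (p ⊗ (s ⊕ q))) ⊕ (q ⊗ (s ⊕ p))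
  nbr-degree-sum Ac = (s ⊗ k) ⊕ (q ⊗ (s ⊕ p))
  nbr-degree-sum Bc = (s ⊗ k) ⊕ (p ⊗ (s ⊕ q))

  class-total : (Cls → A) → A
  class-total f = ((s ⊗ f Kc) ⊕ (p ⊗ f Ac)) ⊕ (q ⊗ f Bc)

  sum-of-squares : A
  sum-of-squares = class-total (λ c → degree c ⊗ degree c)

  degree-nbr-sum : A
  degree-nbr-sum = class-total (λ c → degree c ⊗ nbr-degree-sum c)

-- The four indices of the class graph with sizes s, p, q on k+1 vertices
-- (M₂ᶜ is twice the second Zagreb index).
degree-product : ℕ → ℕ → ℕ → ℕ → ℕ
degree-product k s p q = k ^ s * (s + q) ^ p * (s + p) ^ q

M₁ᶜ M₂ᶜ Π₁ᶜ Π₂ᶜ : ℕ → ℕ → ℕ → ℕ → ℕ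
M₁ᶜ k s p q = DegreePolynomials.sum-of-squares _+_ _*_ k s (s ∸ 1) p q
M₂ᶜ k s p q = DegreePolynomials.degree-nbr-sum _+_ _*_ k s (s ∸ 1) p q
Π₁ᶜ k s p q = degree-product k s p q * degree-product k s p q
Π₂ᶜ k s p q = (k ^ k) ^ s * ((s + q) ^ (s + q)) ^ p * ((s + p) ^ (s + p)) ^ q

module ClassGraph {k} (κ : Fin (suc k) → Cls) where
  H : Graph (suc k)
  H = classGraph κ

  s p q : ℕ
  s = cnt κ Kc
  p = cnt κ Ac
  q = cnt κ Bc

  open DegreePolynomials _+_ _*_ k s (s ∸ 1) p q using (degree; nbr-degree-sum)

  degH : ∀ i → deg H i ≡ degree (κ i)
  degH i with κ i | nbr-class-sum κ i (λ _ → 1)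
  ... | Kc | h = suc-injective (trans (+-comm 1 _) (trans h (trans (by-one s p q) (cnt-total κ))))
    where
    by-one : ∀ a b c → a * 1 + b * 1 + c * 1 ≡ a + b + c
    by-one = solve-∀
  ... | Ac | h = trans (sym (+-identityʳ _)) (trans h (by-one s p q))
    where
    by-one : ∀ a b c → a * 1 + b * 0 + c * 1 ≡ a + c
    by-one = solve-∀
  ... | Bc | h = trans (sym (+-identityʳ _)) (trans h (by-one s p q))
    where
    by-one : ∀ a b c → a * 1 + b * 1 + c * 0 ≡ a + b
    by-one = solve-∀

  nbr-sumH : ∀ i → sumF (λ j → if adj H i j then deg H j else 0) ≡ nbr-degree-sum (κ i)
  nbr-sumH i = trans (sumF-cong (λ j → cong (λ x → if adj H i j then x else 0) (degH j)))
                     (by-class (κ i) refl (nbr-class-sum κ i degree))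
    where
    X : ℕ
    X = sumF (λ j → if classAdj κ i j then degree (κ j) else 0)
    by-class : ∀ c → κ i ≡ c →
      X + (if link c c then degree c else 0)
        ≡ s * (if link c Kc then degree Kc else 0) + p * (if link c Ac then degree Ac else 0)
          + q * (if link c Bc then degree Bc else 0)
      → X ≡ nbr-degree-sum c
    by-class Kc e h = drop-self s (subst (λ c → 1 ≤ cnt κ c) e (cnt-self κ i)) h
      where
      drop-self : ∀ s → 1 ≤ s → X + k ≡ s * k + p * (s + q) + q * (s + p) →
                  X ≡ (s ∸ 1) * k + p * (s + q) + q * (s + p)
      drop-self (suc s') _ h = +-cancelʳ-≡ k X _ (trans h (lemma k s' (p * (suc s' + q)) (q * (suc s' + p))))
        where
        lemma : ∀ k s P Q → suc s * k + P + Q ≡ s * k + P + Q + k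
        lemma = solve-∀
    by-class Ac e h = trans (sym (+-identityʳ X)) (trans h (lemma s k p (q * (s + p))))
      where
      lemma : ∀ s k p Q → s * k + p * 0 + Q ≡ s * k + Q
      lemma = solve-∀
    by-class Bc e h = trans (sym (+-identityʳ X)) (trans h (lemma s k q (p * (s + q))))
      where
      lemma : ∀ s k q P → s * k + P + q * 0 ≡ s * k + P
      lemma = solve-∀

  square≡ : ∀ i → deg H i ^ 2 ≡ degree (κ i) * degree (κ i)
  square≡ i = trans (cong (deg H i *_) (*-identityʳ (deg H i))) (cong (λ x → x * x) (degH i))

  M₁-class : M₁ H ≡ M₁ᶜ k s p q
  M₁-class = trans (sumF-cong square≡) (class-sum κ (λ c → degree c * degree c))

  M₂-class : 2 * M₂ H ≡ M₂ᶜ k s p q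
  M₂-class = trans (M₂-by-vertices H) (trans (sumF-cong (λ i → cong₂ _*_ (degH i) (nbr-sumH i)))
                   (class-sum κ (λ c → degree c * nbr-degree-sum c)))

  Π₁-class : Π₁ H ≡ Π₁ᶜ k s p q
  Π₁-class = trans (prodF-cong square≡)
             (trans (prodF-* (degree ∘ κ) (degree ∘ κ)) (cong₂ _*_ (class-prod κ degree) (class-prod κ degree)))

  Π₂-class : Π₂ H ≡ Π₂ᶜ k s p q
  Π₂-class = trans (Π₂-by-vertices H) (trans (prodF-cong (λ i → cong (λ x → x ^ x) (degH i)))
                   (class-prod κ (λ c → degree c ^ degree c)))

-- Graphs of vertex 2-partiteness ≤ m live inside class graphs
--
-- Put the deleted set S into class K and colour the remaining vertices A/B
-- by the proper 2-colouring.

classOf : ∀ {n} → Subset n → (Fin n → Bool) → Fin n → Cls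
classOf S side i = if lookup S i then Kc else (if side i then Ac else Bc)

cnt-classOf : ∀ {n} (S : Subset n) (side : Fin n → Bool) → ∣ S ∣ ≡ cnt (classOf S side) Kc
cnt-classOf [] side = refl
cnt-classOf (true ∷ S) side = cong suc (cnt-classOf S (side ∘ F.suc))
cnt-classOf (false ∷ S) side with side F.zero
... | true = cnt-classOf S (side ∘ F.suc)
... | false = cnt-classOf S (side ∘ F.suc)

module BipartiteAfterDeletion {n} (G : Graph n) (S : Subset n) (side : Fin n → Bool)
  (proper : ∀ i j → i ∉ S → j ∉ S → adj G i j ≡ true → side i ≢ side j) where

  ∉S : ∀ i → lookup S i ≡ false → i ∉ S
  ∉S i e i∈S = false≢true (trans (sym e) ([]=⇒lookup i∈S))

  distinct : ∀ i j → adj G i j ≡ true → does (i F.≟ j) ≡ false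
  distinct i j e with i F.≟ j
  ... | no _ = refl
  ... | yes refl = ⊥-elim (false≢true (trans (sym (irrefl G i)) e))

  linked : ∀ i j → adj G i j ≡ true → link (classOf S side i) (classOf S side j) ≡ true
  linked i j e with lookup S i in Si | lookup S j in Sj
  ... | true | _ = refl
  ... | false | true with side i
  ...   | true = refl
  ...   | false = refl
  linked i j e | false | false with side i in ci | side j in cj
  ... | true | false = refl
  ... | false | true = refl
  ... | true | true = ⊥-elim (proper i j (∉S i Si) (∉S j Sj) e (trans ci (sym cj)))
  ... | false | false = ⊥-elim (proper i j (∉S i Si) (∉S j Sj) e (trans ci (sym cj)))

  ⊆classGraph : G ⊆ᴳ classGraph (classOf S side)
  ⊆classGraph i j e = subst (λ b → not b ∧ link (classOf S side i) (classOf S side j) ≡ true)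
                            (sym (distinct i j e)) (linked i j e)

-- The join graphs of the statement are class graphs

joinClasses : ∀ {n} → ℕ → ℕ → Fin n → Cls
joinClasses m a i = if toℕ i <ᵇ m then Kc else (if toℕ i <ᵇ m + a then Ac else Bc)

code : Cls → ℕ
code Kc = 0
code Ac = 1
code Bc = 2

joinAdj≡classAdj : ∀ {n} m a (i j : Fin n) → joinAdj m a i j ≡ classAdj (joinClasses m a) i j
joinAdj≡classAdj m a i j =
  trans (cong₂ (λ x y → not (does (i F.≟ j)) ∧ (eqℕ x 0 ∨ eqℕ y 0 ∨ not (eqℕ x y)))
               (code-if (toℕ i <ᵇ m) (toℕ i <ᵇ m + a)) (code-if (toℕ j <ᵇ m) (toℕ j <ᵇ m + a)))
        (cong (not (does (i F.≟ j)) ∧_) (link-by-codes (joinClasses m a i) (joinClasses m a j)))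
  where
  code-if : ∀ (b₁ b₂ : Bool) → (if b₁ then 0 else (if b₂ then 1 else 2)) ≡ code (if b₁ then Kc else (if b₂ then Ac else Bc))
  code-if true b₂ = refl
  code-if false true = refl
  code-if false false = refl
  link-by-codes : ∀ c d → (eqℕ (code c) 0 ∨ eqℕ (code d) 0 ∨ not (eqℕ (code c) (code d))) ≡ link c d
  link-by-codes Kc Kc = refl
  link-by-codes Kc Ac = refl
  link-by-codes Kc Bc = refl
  link-by-codes Ac Kc = refl
  link-by-codes Ac Ac = refl
  link-by-codes Ac Bc = refl
  link-by-codes Bc Kc = refl
  link-by-codes Bc Ac = refl
  link-by-codes Bc Bc = refl

count-below : ∀ n k → k ≤ n → sumF {n} (λ i → ind (toℕ i <ᵇ k)) ≡ k
count-below zero zero _ = refl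
count-below (suc n) zero _ = trans (sumF-const n 0) (*-zeroʳ n)
count-below (suc n) (suc k) (s≤s k≤n) = cong suc (count-below n k k≤n)

joinClasses-counts : ∀ n m a b → m + a + b ≡ n →
  cnt {n} (joinClasses m a) Kc ≡ m × cnt {n} (joinClasses m a) Ac ≡ a × cnt {n} (joinClasses m a) Bc ≡ b
joinClasses-counts n m a b h = cK , cA , cB
  where
  κ : Fin n → Cls
  κ = joinClasses m a
  m+a≤n : m + a ≤ n
  m+a≤n = subst (m + a ≤_) h (m≤m+n (m + a) b)
  <ᵇ-weaken : ∀ x m a → (x <ᵇ m) ≡ true → (x <ᵇ m + a) ≡ true
  <ᵇ-weaken zero (suc m) a e = refl
  <ᵇ-weaken (suc x) (suc m) a e = <ᵇ-weaken x m a e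
  isK : ∀ i → ind (κ i =ᶜ Kc) ≡ ind (toℕ i <ᵇ m)
  isK i with toℕ i <ᵇ m
  ... | true = refl
  ... | false with toℕ i <ᵇ m + a
  ...   | true = refl
  ...   | false = refl
  isK∨A : ∀ i → ind (κ i =ᶜ Kc) + ind (κ i =ᶜ Ac) ≡ ind (toℕ i <ᵇ m + a)
  isK∨A i with toℕ i <ᵇ m in e
  ... | true rewrite <ᵇ-weaken (toℕ i) m a e = refl
  ... | false with toℕ i <ᵇ m + a
  ...   | true = refl
  ...   | false = refl
  cK : cnt κ Kc ≡ m
  cK = trans (sumF-cong isK) (count-below n m (≤-trans (m≤m+n m a) m+a≤n))
  cKA : cnt κ Kc + cnt κ Ac ≡ m + a
  cKA = trans (sym (sumF-+ (λ i → ind (κ i =ᶜ Kc)) (λ i → ind (κ i =ᶜ Ac))))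
              (trans (sumF-cong isK∨A) (count-below n (m + a) m+a≤n))
  cA : cnt κ Ac ≡ a
  cA = +-cancelˡ-≡ m _ _ (trans (cong (_+ cnt κ Ac) (sym cK)) cKA)
  cB : cnt κ Bc ≡ b
  cB = +-cancelˡ-≡ (m + a) _ _ (trans (cong (_+ cnt κ Bc) (sym cKA)) (trans (cnt-total κ) (sym h)))

find : ∀ {n} (κ : Fin n → Cls) c → 1 ≤ cnt κ c → Σ (Fin n) λ j → κ j ≡ c
find {suc n} κ c h with κ F.zero in e | c
... | Kc | Kc = F.zero , e
... | Ac | Ac = F.zero , e
... | Bc | Bc = F.zero , e
... | Kc | Ac = let (j , p) = find (κ ∘ F.suc) Ac h in F.suc j , p
... | Kc | Bc = let (j , p) = find (κ ∘ F.suc) Bc h in F.suc j , p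
... | Ac | Kc = let (j , p) = find (κ ∘ F.suc) Kc h in F.suc j , p
... | Ac | Bc = let (j , p) = find (κ ∘ F.suc) Bc h in F.suc j , p
... | Bc | Kc = let (j , p) = find (κ ∘ F.suc) Kc h in F.suc j , p
... | Bc | Ac = let (j , p) = find (κ ∘ F.suc) Ac h in F.suc j , p

match : ∀ {n} (κ₁ κ₂ : Fin n → Cls) → (∀ c → cnt κ₁ c ≡ cnt κ₂ c) →
  Σ (Permutation n n) λ σ → ∀ i → κ₁ i ≡ κ₂ (σ ⟨$⟩ʳ i)
match {zero} κ₁ κ₂ h = Perm.id , λ ()
match {suc n} κ₁ κ₂ h = lift₀ (proj₁ rest) ∘ₚ τ , matched
  where
  c : Cls
  c = κ₁ F.zero
  found : Σ (Fin (suc n)) λ j → κ₂ j ≡ c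
  found = find κ₂ c (subst (1 ≤_) (h c) (cnt-self κ₁ F.zero))
  -- swap a vertex of class c to the front, then match the tails
  τ : Permutation (suc n) (suc n)
  τ = transpose F.zero (proj₁ found)
  κ₂' : Fin (suc n) → Cls
  κ₂' i = κ₂ (τ ⟨$⟩ʳ i)
  tails : ∀ c' → cnt (κ₁ ∘ F.suc) c' ≡ cnt (κ₂' ∘ F.suc) c'
  tails c' = +-cancelˡ-≡ (ind (c =ᶜ c')) _ _
    (trans (h c') (trans (sym (sumF-perm τ (λ i → ind (κ₂ i =ᶜ c'))))
                         (cong (λ z → ind (z =ᶜ c') + cnt (κ₂' ∘ F.suc) c') (proj₂ found))))
  rest : Σ (Permutation n n) λ σ → ∀ i → κ₁ (F.suc i) ≡ κ₂' (F.suc (σ ⟨$⟩ʳ i))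
  rest = match (κ₁ ∘ F.suc) (κ₂' ∘ F.suc) tails
  matched : ∀ i → κ₁ i ≡ κ₂ ((lift₀ (proj₁ rest) ∘ₚ τ) ⟨$⟩ʳ i)
  matched F.zero = sym (proj₂ found)
  matched (F.suc i) = proj₂ rest i

≟-perm : ∀ {n} (σ : Permutation n n) i j → does (σ ⟨$⟩ʳ i F.≟ σ ⟨$⟩ʳ j) ≡ does (i F.≟ j)
≟-perm σ i j with i F.≟ j
... | yes refl = ≟-refl (σ ⟨$⟩ʳ i)
... | no i≢j with σ ⟨$⟩ʳ i F.≟ σ ⟨$⟩ʳ j
...   | no _ = refl
...   | yes eq = ⊥-elim (i≢j (trans (sym (Perm.inverseˡ σ)) (trans (cong (σ ⟨$⟩ˡ_) eq) (Perm.inverseˡ σ))))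

swapAB : Cls → Cls
swapAB Kc = Kc
swapAB Ac = Bc
swapAB Bc = Ac

link-swapAB : ∀ c d → link (swapAB c) (swapAB d) ≡ link c d
link-swapAB Kc Kc = refl
link-swapAB Kc Ac = refl
link-swapAB Kc Bc = refl
link-swapAB Ac Kc = refl
link-swapAB Ac Ac = refl
link-swapAB Ac Bc = refl
link-swapAB Bc Kc = refl
link-swapAB Bc Ac = refl
link-swapAB Bc Bc = refl

cnt-swapAB : ∀ {n} (κ : Fin n → Cls) c → cnt (swapAB ∘ κ) c ≡ cnt κ (swapAB c)
cnt-swapAB κ c = sumF-cong (λ i → cong ind (=ᶜ-swap (κ i) c))
  where
  =ᶜ-swap : ∀ c d → (swapAB c =ᶜ d) ≡ (c =ᶜ swapAB d)
  =ᶜ-swap Kc Kc = refl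
  =ᶜ-swap Kc Ac = refl
  =ᶜ-swap Kc Bc = refl
  =ᶜ-swap Ac Kc = refl
  =ᶜ-swap Ac Ac = refl
  =ᶜ-swap Ac Bc = refl
  =ᶜ-swap Bc Kc = refl
  =ᶜ-swap Bc Ac = refl
  =ᶜ-swap Bc Bc = refl

SidesAB : ∀ {n} → (Fin n → Cls) → ℕ → ℕ → Set
SidesAB κ a b = (cnt κ Ac ≡ a × cnt κ Bc ≡ b) ⊎ (cnt κ Ac ≡ b × cnt κ Bc ≡ a)

class-graph≅join : ∀ {n} (κ : Fin n → Cls) m a b → m + a + b ≡ n → cnt κ Kc ≡ m → SidesAB κ a b →
  IsoTo (classGraph κ) (joinAdj m a)
class-graph≅join {n} κ m a b total cK sizes with joinClasses-counts n m a b total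
... | jK , jA , jB = via-relabelling (relabel sizes) (same-links sizes) (same-sizes sizes)
  where
  relabel : SidesAB κ a b → Fin n → Cls
  relabel (inj₁ _) = κ
  relabel (inj₂ _) = swapAB ∘ κ
  same-links : ∀ (sz : SidesAB κ a b) i j → link (κ i) (κ j) ≡ link (relabel sz i) (relabel sz j)
  same-links (inj₁ _) i j = refl
  same-links (inj₂ _) i j = sym (link-swapAB (κ i) (κ j))
  same-sizes : ∀ (sz : SidesAB κ a b) c → cnt (relabel sz) c ≡ cnt (joinClasses {n} m a) c
  same-sizes (inj₁ (cA , cB)) Kc = trans cK (sym jK)
  same-sizes (inj₁ (cA , cB)) Ac = trans cA (sym jA)
  same-sizes (inj₁ (cA , cB)) Bc = trans cB (sym jB)
  same-sizes (inj₂ (cA , cB)) Kc = trans (cnt-swapAB κ Kc) (trans cK (sym jK))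
  same-sizes (inj₂ (cA , cB)) Ac = trans (cnt-swapAB κ Ac) (trans cB (sym jA))
  same-sizes (inj₂ (cA , cB)) Bc = trans (cnt-swapAB κ Bc) (trans cA (sym jB))
  via-relabelling : ∀ (κ' : Fin n → Cls) → (∀ i j → link (κ i) (κ j) ≡ link (κ' i) (κ' j)) →
    (∀ c → cnt κ' c ≡ cnt (joinClasses {n} m a) c) → IsoTo (classGraph κ) (joinAdj m a)
  via-relabelling κ' links sizes' = σ , preserves
    where
    σ : Permutation n n
    σ = proj₁ (match κ' (joinClasses m a) sizes')
    preserves : ∀ i j → classAdj κ i j ≡ joinAdj m a (σ ⟨$⟩ʳ i) (σ ⟨$⟩ʳ j)
    preserves i j =
      trans (cong₂ (λ x y → not x ∧ y) (sym (≟-perm σ i j))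
              (trans (links i j) (cong₂ link (proj₂ (match κ' _ sizes') i) (proj₂ (match κ' _ sizes') j))))
            (sym (joinAdj≡classAdj m a (σ ⟨$⟩ʳ i) (σ ⟨$⟩ʳ j)))

module Isomorphic {n} (G H : Graph n) (σ : Fin n ↔ Fin n)
  (preserves : ∀ i j → adj G i j ≡ adj H (Inverse.to σ i) (Inverse.to σ j)) where

  σ→ : Fin n → Fin n
  σ→ = Inverse.to σ

  deg-σ : ∀ i → deg G i ≡ deg H (σ→ i)
  deg-σ i = trans (sumF-cong (λ j → cong ind (preserves i j))) (sumF-perm σ (ind ∘ adj H (σ→ i)))

  M₁-invariant : M₁ G ≡ M₁ H
  M₁-invariant = trans (sumF-cong (λ i → cong (_^ 2) (deg-σ i))) (sumF-perm σ (λ i → deg H i ^ 2))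

  Π₁-invariant : Π₁ G ≡ Π₁ H
  Π₁-invariant = trans (prodF-cong (λ i → cong (_^ 2) (deg-σ i))) (prodF-perm σ (λ i → deg H i ^ 2))

  Π₂-invariant : Π₂ G ≡ Π₂ H
  Π₂-invariant = trans (Π₂-by-vertices G) (trans (prodF-cong (λ i → cong (λ x → x ^ x) (deg-σ i)))
                   (trans (prodF-perm σ (λ i → deg H i ^ deg H i)) (sym (Π₂-by-vertices H))))

  M₂-invariant : M₂ G ≡ M₂ H
  M₂-invariant = *-cancelˡ-≡ (M₂ G) (M₂ H) 2
    (trans (M₂-by-vertices G) (trans (sumF-cong vertex-term)
      (trans (sumF-perm σ (λ i → deg H i * sumF (λ j → if adj H i j then deg H j else 0))) (sym (M₂-by-vertices H)))))
    where
    vertex-term : ∀ i → deg G i * sumF (λ j → if adj G i j then deg G j else 0)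
                      ≡ deg H (σ→ i) * sumF (λ j → if adj H (σ→ i) j then deg H j else 0)
    vertex-term i = cong₂ _*_ (deg-σ i)
      (trans (sumF-cong (λ j → cong₂ (λ b x → if b then x else 0) (preserves i j) (deg-σ j)))
             (sumF-perm σ (λ j → if adj H (σ→ i) j then deg H j else 0)))

-- Maximising a function of the class sizes
--
-- Let Φ(s, p, q) be symmetric in p, q, considered on s + p + q = N with
-- s ≤ m, where N = m + (b + r) + b, r ≤ 1, m + 2 ≤ N.  Suppose that
--   (into-K)  while s < m, moving a vertex from a side of size ≥ 2 into K
--             strictly increases Φ, and
--   (balance) at s = m, moving a vertex from the larger side to the smaller
--             one strictly increases Φ while the sides differ by ≥ 2.
-- Then Φ ≤ Φ(m, b + r, b), with equality only at s = m, {p, q} = {b + r, b}.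

halves : ∀ {q g b r} → g ≤ 1 → r ≤ 1 → q + g + q ≡ b + r + b → q ≡ b × g ≡ r
halves {q} {g} {b} {r} g≤1 r≤1 h with <-cmp q b
... | tri≈ _ refl _ = refl , +-cancelʳ-≡ b g r (+-cancelˡ-≡ b (g + b) (r + b) (trans (sym (+-assoc b g b)) (trans h (+-assoc b r b))))
... | tri< q<b _ _ = ⊥-elim (<-irrefl h (begin-strict
    q + g + q ≤⟨ +-monoˡ-≤ q (+-monoʳ-≤ q g≤1) ⟩
    q + 1 + q ≡⟨ cong (_+ q) (+-comm q 1) ⟩
    suc q + q <⟨ +-mono-≤-< q<b q<b ⟩
    b + b     ≤⟨ +-monoˡ-≤ b (m≤m+n b r) ⟩
    b + r + b ∎))
  where open ≤-Reasoning
... | tri> _ _ b<q = ⊥-elim (<-irrefl (sym h) (begin-strict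
    b + r + b ≤⟨ +-monoˡ-≤ b (+-monoʳ-≤ b r≤1) ⟩
    b + 1 + b ≡⟨ cong (_+ b) (+-comm b 1) ⟩
    suc b + b <⟨ +-mono-≤-< b<q b<q ⟩
    q + q     ≤⟨ +-monoˡ-≤ q (m≤m+n q g) ⟩
    q + g + q ∎))
  where open ≤-Reasoning

module Maximise (Φ : ℕ → ℕ → ℕ → ℕ) (N m b r : ℕ)
  (r≤1 : r ≤ 1) (N≡ : m + (b + r) + b ≡ N) (m+2≤N : m + 2 ≤ N)
  (Φ-sym : ∀ s p q → Φ s p q ≡ Φ s q p)
  (into-K : ∀ s p q → s + (2 + p) + q ≡ N → s < m → Φ s (2 + p) q < Φ (1 + s) (1 + p) q)
  (balance : ∀ q d → m + (q + (2 + d)) + q ≡ N → Φ m (q + (2 + d)) q < Φ m (q + 1 + d) (q + 1))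
  where

  Φ* : ℕ
  Φ* = Φ m (b + r) b

  Balanced : ℕ → ℕ → Set
  Balanced p q = (p ≡ b + r × q ≡ b) ⊎ (p ≡ b × q ≡ b + r)

  Optimal : ℕ → ℕ → ℕ → Set
  Optimal s p q = Φ s p q ≤ Φ* × (Φ s p q ≡ Φ* → s ≡ m × Balanced p q)

  swap-sides : ∀ {s p q} → Optimal s q p → Optimal s p q
  swap-sides {s} {p} {q} (le , eq) = subst (_≤ Φ*) (Φ-sym s q p) le ,
    λ e → let (s≡m , bal) = eq (trans (Φ-sym s q p) e) in s≡m , swap bal
    where
    swap : Balanced q p → Balanced p q
    swap (inj₁ (x , y)) = inj₂ (y , x)
    swap (inj₂ (x , y)) = inj₁ (y , x)

  below : ∀ {s p q x} → Φ s p q < x → x ≤ Φ* → Optimal s p q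
  below lt le = <⇒≤ (<-≤-trans lt le) , λ e → ⊥-elim (<-irrefl e (<-≤-trans lt le))

  settled : ∀ q g → g ≤ 1 → m + (q + g) + q ≡ N → Optimal m (q + g) q
  settled q g g≤1 h with halves {q} {g} {b} {r} g≤1 r≤1 (+-cancelˡ-≡ m _ _
    (trans (sym (+-assoc m (q + g) q)) (trans h (trans (sym N≡) (+-assoc m (b + r) b)))))
  ... | refl , refl = ≤-refl , λ _ → refl , inj₁ (refl , refl)

  -- at s = m: recursion on the gap g between the sides
  at-m : ∀ q g → m + (q + g) + q ≡ N → Optimal m (q + g) q
  at-m q (suc (suc d)) h = below (balance q d h) (proj₁ (at-m (q + 1) d h'))
    where
    h' : m + (q + 1 + d) + (q + 1) ≡ N
    h' = trans (lemma m q d) h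
      where
      lemma : ∀ m q d → m + (q + 1 + d) + (q + 1) ≡ m + (q + (2 + d)) + q
      lemma = solve-∀
  at-m q 0 h = settled q 0 z≤n h
  at-m q 1 h = settled q 1 ≤-refl h

  at-m-any : ∀ p q → m + p + q ≡ N → Optimal m p q
  at-m-any p q h with ≤-total q p
  ... | inj₁ q≤p = subst (λ x → Optimal m x q) (m+[n∸m]≡n q≤p)
                     (at-m q (p ∸ q) (subst (λ x → m + x + q ≡ N) (sym (m+[n∸m]≡n q≤p)) h))
  ... | inj₂ p≤q = swap-sides (subst (λ x → Optimal m x p) (m+[n∸m]≡n p≤q)
                     (at-m p (q ∸ p) (subst (λ x → m + x + p ≡ N) (sym (m+[n∸m]≡n p≤q)) h')))
    where
    h' : m + q + p ≡ N
    h' = trans (+-assoc m q p) (trans (cong (_+_ m) (+-comm q p)) (trans (sym (+-assoc m p q)) h))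

  -- below m the sides hold at least three vertices, so the larger has ≥ 2
  larger-side≥2 : ∀ s p q → s < m → s + p + q ≡ N → q ≤ p → 2 ≤ p
  larger-side≥2 s p q s<m h q≤p with 2 ≤? p
  ... | yes 2≤p = 2≤p
  ... | no p≱2 = ⊥-elim (<-irrefl refl (≤-trans 3≤p+q (+-mono-≤ p≤1 (≤-trans q≤p p≤1))))
    where
    p≤1 : p ≤ 1
    p≤1 = ≤-pred (≰⇒> p≱2)
    3≤p+q : 3 ≤ p + q
    3≤p+q = +-cancelˡ-≤ s 3 (p + q) (begin
      s + 3     ≡⟨ +-comm s 3 ⟩
      3 + s     ≤⟨ +-monoʳ-≤ 2 s<m ⟩
      2 + m     ≡⟨ +-comm 2 m ⟩
      m + 2     ≤⟨ m+2≤N ⟩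
      N         ≡⟨ trans (sym h) (+-assoc s p q) ⟩
      s + (p + q) ∎)
      where open ≤-Reasoning

  step-into-K : ∀ s p q → s < m → q ≤ p → s + p + q ≡ N →
    (∀ p' q' → suc s + p' + q' ≡ N → Optimal (suc s) p' q') → Optimal s p q
  step-into-K s p q s<m q≤p h next with larger-side≥2 s p q s<m h q≤p
  step-into-K s (suc (suc p')) q s<m q≤p h next | s≤s (s≤s _) =
    below (into-K s p' q h s<m) (proj₁ (next (suc p') q (trans (cong (_+ q) (sym (+-suc s (suc p')))) h)))

  -- below m: recursion on the distance g from s to m
  raise : ∀ g s p q → s + g ≡ m → s + p + q ≡ N → Optimal s p q
  raise zero s p q e h rewrite +-identityʳ s | e = at-m-any p q h
  raise (suc g) s p q e h = by-order (≤-total q p)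
    where
    s<m : s < m
    s<m = subst (s <_) e (subst (_≤ s + suc g) (+-comm s 1) (+-monoʳ-≤ s (s≤s z≤n)))
    next : ∀ p' q' → suc s + p' + q' ≡ N → Optimal (suc s) p' q'
    next p' q' = raise g (suc s) p' q' (trans (sym (+-suc s g)) e)
    by-order : q ≤ p ⊎ p ≤ q → Optimal s p q
    by-order (inj₁ q≤p) = step-into-K s p q s<m q≤p h next
    by-order (inj₂ p≤q) = swap-sides (step-into-K s q p s<m p≤q h' next)
      where
      h' : s + q + p ≡ N
      h' = trans (+-assoc s q p) (trans (cong (_+_ s) (+-comm q p)) (trans (sym (+-assoc s p q)) h))

  optimum : ∀ s p q → s ≤ m → s + p + q ≡ N → Optimal s p q
  optimum s p q s≤m = raise (m ∸ s) s p q (m+[n∸m]≡n s≤m)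

-- The exchange inequalities for the four class functions
--
-- Each step is stated at the vertex count k + 1 it forces (k = s + p + q + 1
-- resp. k = s + q + q + d + 1).  For M₁ and M₂ each step is an identity
-- "after = before + (2 + surplus)" with a surplus that is a polynomial
-- with non-negative coefficients.  For Π₁ and Π₂ the steps compare
-- products of powers factor by factor.

into-K-size : ∀ {k s p q} → s + (2 + p) + q ≡ suc k → k ≡ s + p + q + 1
into-K-size {k} {s} {p} {q} h = suc-injective (trans (sym h) (lemma s p q))
  where
  lemma : ∀ s p q → s + (2 + p) + q ≡ 1 + (s + p + q + 1)
  lemma = solve-∀

balance-size : ∀ {k s q d} → s + (q + (2 + d)) + q ≡ suc k → k ≡ s + q + q + d + 1
balance-size {k} {s} {q} {d} h = suc-injective (trans (sym h) (lemma s q d))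
  where
  lemma : ∀ s q d → s + (q + (2 + d)) + q ≡ 1 + (s + q + q + d + 1)
  lemma = solve-∀

<-by-surplus : ∀ {x y} r → y ≡ x + (2 + r) → x < y
<-by-surplus {x} r refl = m<m+n x (s≤s z≤n)

sides-sym : ∀ X Y Z → X * Y * Z ≡ X * Z * Y
sides-sym = solve-∀

M₁ᶜ-sym : ∀ k s p q → M₁ᶜ k s p q ≡ M₁ᶜ k s q p
M₁ᶜ-sym k s p q = lemma k s p q
  where
  lemma : ∀ k s p q → s * (k * k) + p * ((s + q) * (s + q)) + q * ((s + p) * (s + p))
                    ≡ s * (k * k) + q * ((s + p) * (s + p)) + p * ((s + q) * (s + q))
  lemma = solve-∀

M₁ᶜ-into-K : ∀ s p q → let k = s + p + q + 1 in M₁ᶜ k s (2 + p) q < M₁ᶜ k (1 + s) (1 + p) q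
M₁ᶜ-into-K s p q = <-by-surplus _ (identity s p q)
  where
  identity : ∀ s p q → let K = s + p + q + 1 in
      (1 + s) * (K * K) + (1 + p) * ((1 + s + q) * (1 + s + q)) + q * ((1 + s + (1 + p)) * (1 + s + (1 + p)))
    ≡ s * (K * K) + (2 + p) * ((s + q) * (s + q)) + q * ((s + (2 + p)) * (s + (2 + p)))
      + (2 + (4 * s * p + 4 * s + p * p + 4 * p * q + 3 * p + 4 * q))
  identity = solve-∀

M₁ᶜ-balance : ∀ s q d → let k = s + q + q + d + 1 in
  M₁ᶜ k s (q + (2 + d)) q < M₁ᶜ k s (q + 1 + d) (q + 1)
M₁ᶜ-balance s q d = <-by-surplus _ (identity s q d)
  where
  identity : ∀ s q d → let K = s + q + q + d + 1 in
      s * (K * K) + (q + 1 + d) * ((s + (q + 1)) * (s + (q + 1))) + (q + 1) * ((s + (q + 1 + d)) * (s + (q + 1 + d)))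
    ≡ s * (K * K) + (q + (2 + d)) * ((s + q) * (s + q)) + q * ((s + (q + (2 + d))) * (s + (q + (2 + d))))
      + (2 + (4 * s * d + 4 * s + 2 * q * d + 2 * q + d * d + 3 * d))
  identity = solve-∀

-- M₂ (twice the index); the clique term needs s - 1, hence the case split

M₂ᶜ-sym : ∀ k s p q → M₂ᶜ k s p q ≡ M₂ᶜ k s q p
M₂ᶜ-sym k s p q = lemma k s p q (s ∸ 1)
  where
  lemma : ∀ k s p q s⁻ →
      s * (k * (s⁻ * k + p * (s + q) + q * (s + p))) + p * ((s + q) * (s * k + q * (s + p))) + q * ((s + p) * (s * k + p * (s + q)))
    ≡ s * (k * (s⁻ * k + q * (s + p) + p * (s + q))) + q * ((s + p) * (s * k + p * (s + q))) + p * ((s + q) * (s * k + q * (s + p)))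
  lemma = solve-∀

M₂ᶜ-into-empty-K : ∀ p q → let s = 0 ; k = s + p + q + 1 in M₂ᶜ k s (2 + p) q < M₂ᶜ k (1 + s) (1 + p) q
M₂ᶜ-into-empty-K p q = <-by-surplus _ (identity p q)
  where
  identity : ∀ p q → let s = 0 ; K = s + p + q + 1 in
      (1 + s) * (K * (0 * K + (1 + p) * (1 + s + q) + q * (1 + s + (1 + p))))
      + (1 + p) * ((1 + s + q) * ((1 + s) * K + q * (1 + s + (1 + p))))
      + q * ((1 + s + (1 + p)) * ((1 + s) * K + (1 + p) * (1 + s + q)))
    ≡ s * (K * (0 * K + (2 + p) * (s + q) + q * (s + (2 + p))))
      + (2 + p) * ((s + q) * (s * K + q * (s + (2 + p))))
      + q * ((s + (2 + p)) * (s * K + (2 + p) * (s + q)))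
      + (2 + (6 * p * p * q + 2 * p * p + 2 * p * q * q + 18 * p * q + 4 * p + 2 * q * q + 12 * q))
  identity = solve-∀

M₂ᶜ-into-nonempty-K : ∀ t p q → let s = 1 + t ; k = s + p + q + 1 in M₂ᶜ k s (2 + p) q < M₂ᶜ k (1 + s) (1 + p) q
M₂ᶜ-into-nonempty-K t p q = <-by-surplus _ (identity t p q)
  where
  identity : ∀ t p q → let s = 1 + t ; K = s + p + q + 1 in
      (1 + s) * (K * (s * K + (1 + p) * (1 + s + q) + q * (1 + s + (1 + p))))
      + (1 + p) * ((1 + s + q) * ((1 + s) * K + q * (1 + s + (1 + p))))
      + q * ((1 + s + (1 + p)) * ((1 + s) * K + (1 + p) * (1 + s + q)))
    ≡ s * (K * (t * K + (2 + p) * (s + q) + q * (s + (2 + p))))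
      + (2 + p) * ((s + q) * (s * K + q * (s + (2 + p))))
      + q * ((s + (2 + p)) * (s * K + (2 + p) * (s + q)))
      + (2 + (6 * s * s * p + 6 * s * s + 6 * s * p * p + 12 * s * p * q + 14 * s * p + 12 * s * q + 8 * s
              + 6 * p * p * q + 2 * p * p + 2 * p * q * q + 18 * p * q + 4 * p + 2 * q * q + 12 * q))
  identity = solve-∀

M₂ᶜ-into-K : ∀ s p q → let k = s + p + q + 1 in M₂ᶜ k s (2 + p) q < M₂ᶜ k (1 + s) (1 + p) q
M₂ᶜ-into-K zero = M₂ᶜ-into-empty-K
M₂ᶜ-into-K (suc t) = M₂ᶜ-into-nonempty-K t

M₂ᶜ-balance : ∀ t q d → let s = 1 + t ; k = s + q + q + d + 1 in
  M₂ᶜ k s (q + (2 + d)) q < M₂ᶜ k s (q + 1 + d) (q + 1)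
M₂ᶜ-balance t q d = <-by-surplus _ (identity t q d)
  where
  identity : ∀ t q d → let s = 1 + t ; K = s + q + q + d + 1 in
      s * (K * (t * K + (q + 1 + d) * (s + (q + 1)) + (q + 1) * (s + (q + 1 + d))))
      + (q + 1 + d) * ((s + (q + 1)) * (s * K + (q + 1) * (s + (q + 1 + d))))
      + (q + 1) * ((s + (q + 1 + d)) * (s * K + (q + 1 + d) * (s + (q + 1))))
    ≡ s * (K * (t * K + (q + (2 + d)) * (s + q) + q * (s + (q + (2 + d)))))
      + (q + (2 + d)) * ((s + q) * (s * K + q * (s + (q + (2 + d)))))
      + q * ((s + (q + (2 + d))) * (s * K + (q + (2 + d)) * (s + q)))
      + (2 + (6 * s * s * d + 6 * s * s + 12 * s * q * d + 12 * s * q + 6 * s * d * d + 14 * s * d + 8 * s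
              + 4 * q * q * d + 4 * q * q + 4 * q * d * d + 12 * q * d + 8 * q + 2 * d * d + 4 * d))
  identity = solve-∀

*-^ : ∀ a b n → (a * b) ^ n ≡ a ^ n * b ^ n
*-^ a b zero = refl
*-^ a b (suc n) = trans (cong (a * b *_) (*-^ a b n)) (lemma a b (a ^ n) (b ^ n))
  where
  lemma : ∀ a b x y → a * b * (x * y) ≡ a * x * (b * y)
  lemma = solve-∀

^-pos : ∀ {x} n → 0 < x → 0 < x ^ n
^-pos {suc x} n _ = m^n>0 (suc x) n

^-+-+ : ∀ x a b c → x ^ (a + b + c) ≡ x ^ a * x ^ b * x ^ c
^-+-+ x a b c = trans (^-distribˡ-+-* x (a + b) c) (cong (_* x ^ c) (^-distribˡ-+-* x a b))

^-+-+-+ : ∀ x a b c e → x ^ (a + b + c + e) ≡ x ^ a * x ^ b * x ^ c * x ^ e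
^-+-+-+ x a b c e = trans (^-distribˡ-+-* x (a + b + c) e) (cong (_* x ^ e) (^-+-+ x a b c))

self-power≥1 : ∀ x → 1 ≤ x ^ x
self-power≥1 zero = ≤-refl
self-power≥1 (suc x) = m^n>0 (suc x) (suc x)

self-power-mono : ∀ {x y} → x ≤ y → x ^ x ≤ y ^ y
self-power-mono {zero} {y} _ = self-power≥1 y
self-power-mono {suc x} {suc y} x≤y = ≤-trans (^-monoˡ-≤ (suc x) x≤y) (^-monoʳ-≤ (suc y) x≤y)

self-power-< : ∀ {x y} → x < y → 2 ≤ y → x ^ x < y ^ y
self-power-< {x} {y} x<y y≥2 = ≤-<-trans (^-monoˡ-≤ x (<⇒≤ x<y)) (^-monoʳ-< y y≥2 x<y)

exchange-< : ∀ X Y' Y Z s p q → Y' < X → Y' ≤ Y → 1 ≤ Y → 1 ≤ Z →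
  X ^ s * Y' ^ (2 + p) * Z ^ q < X ^ (1 + s) * Y ^ (1 + p) * Z ^ q
exchange-< X Y' Y Z s p q Y'<X Y'≤Y Y≥1 Z≥1 =
  subst (X ^ s * Y' ^ (2 + p) * Z ^ q <_) (rearrange X (X ^ s) (Y ^ (1 + p)) (Z ^ q))
    (*-monoˡ-< (Z ^ q) {{>-nonZero (^-pos q Z≥1)}}
      (*-monoʳ-< (X ^ s) {{>-nonZero (^-pos s (≤-<-trans z≤n Y'<X))}} moved))
  where
  rearrange : ∀ X A U C → A * (X * U) * C ≡ X * A * U * C
  rearrange = solve-∀
  moved : Y' * Y' ^ (1 + p) < X * Y ^ (1 + p)
  moved = ≤-<-trans (*-monoʳ-≤ Y' (^-monoˡ-≤ (1 + p) Y'≤Y))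
                    (*-monoˡ-< (Y ^ (1 + p)) {{>-nonZero (^-pos (1 + p) Y≥1)}} Y'<X)

balance-< : ∀ C x y u v a₁ a₂ a₃ a₄ b₁ → 0 < C → x * y ≤ u * v → x ≤ u → x < v → 0 < u → 0 < v →
  a₁ ≤ b₁ → 1 ≤ a₄ →
  C * x ^ (a₁ + a₂ + a₃ + a₄) * y ^ (a₁ + a₂) < C * u ^ (b₁ + a₂ + a₃) * v ^ (b₁ + a₂ + a₄)
balance-< C x y u v a₁ a₂ a₃ a₄ b₁ C>0 xy≤uv x≤u x<v u>0 v>0 a₁≤b₁ a₄≥1 =
  subst₂ _<_ (sym before) (sym after)
    (*-monoʳ-< C {{>-nonZero C>0}}
      (≤-<-trans (*-monoˡ-≤ (x ^ a₄) (*-mono-≤ (*-mono-≤ first second) third))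
                 (*-monoʳ-< ((u * v) ^ b₁ * (u * v) ^ a₂ * u ^ a₃)
                    {{>-nonZero (*-pos (*-pos (^-pos b₁ uv>0) (^-pos a₂ uv>0)) (^-pos a₃ u>0))}}
                    (^-monoˡ-< a₄ {{>-nonZero a₄≥1}} x<v))))
  where
  uv>0 : 0 < u * v
  uv>0 = *-pos u>0 v>0
  first : (x * y) ^ a₁ ≤ (u * v) ^ b₁
  first = ≤-trans (^-monoˡ-≤ a₁ xy≤uv) (^-monoʳ-≤ (u * v) {{>-nonZero uv>0}} a₁≤b₁)
  second : (x * y) ^ a₂ ≤ (u * v) ^ a₂
  second = ^-monoˡ-≤ a₂ xy≤uv
  third : x ^ a₃ ≤ u ^ a₃
  third = ^-monoˡ-≤ a₃ x≤u
  before : C * x ^ (a₁ + a₂ + a₃ + a₄) * y ^ (a₁ + a₂) ≡ C * ((x * y) ^ a₁ * (x * y) ^ a₂ * x ^ a₃ * x ^ a₄)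
  before = begin
    C * x ^ (a₁ + a₂ + a₃ + a₄) * y ^ (a₁ + a₂)
      ≡⟨ cong₂ (λ z w → C * z * w) (^-+-+-+ x a₁ a₂ a₃ a₄) (^-distribˡ-+-* y a₁ a₂) ⟩
    C * (x ^ a₁ * x ^ a₂ * x ^ a₃ * x ^ a₄) * (y ^ a₁ * y ^ a₂)
      ≡⟨ regroup C (x ^ a₁) (x ^ a₂) (x ^ a₃) (x ^ a₄) (y ^ a₁) (y ^ a₂) ⟩
    C * ((x ^ a₁ * y ^ a₁) * (x ^ a₂ * y ^ a₂) * x ^ a₃ * x ^ a₄)
      ≡⟨ cong₂ (λ z w → C * (z * w * x ^ a₃ * x ^ a₄)) (sym (*-^ x y a₁)) (sym (*-^ x y a₂)) ⟩
    C * ((x * y) ^ a₁ * (x * y) ^ a₂ * x ^ a₃ * x ^ a₄) ∎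
    where
    open ≡-Reasoning
    regroup : ∀ K a b c e f g → K * (a * b * c * e) * (f * g) ≡ K * ((a * f) * (b * g) * c * e)
    regroup = solve-∀
  after : C * u ^ (b₁ + a₂ + a₃) * v ^ (b₁ + a₂ + a₄) ≡ C * ((u * v) ^ b₁ * (u * v) ^ a₂ * u ^ a₃ * v ^ a₄)
  after = begin
    C * u ^ (b₁ + a₂ + a₃) * v ^ (b₁ + a₂ + a₄)
      ≡⟨ cong₂ (λ z w → C * z * w) (^-+-+ u b₁ a₂ a₃) (^-+-+ v b₁ a₂ a₄) ⟩
    C * (u ^ b₁ * u ^ a₂ * u ^ a₃) * (v ^ b₁ * v ^ a₂ * v ^ a₄)
      ≡⟨ regroup C (u ^ b₁) (u ^ a₂) (u ^ a₃) (v ^ b₁) (v ^ a₂) (v ^ a₄) ⟩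
    C * ((u ^ b₁ * v ^ b₁) * (u ^ a₂ * v ^ a₂) * u ^ a₃ * v ^ a₄)
      ≡⟨ cong₂ (λ z w → C * (z * w * u ^ a₃ * v ^ a₄)) (sym (*-^ u v b₁)) (sym (*-^ u v a₂)) ⟩
    C * ((u * v) ^ b₁ * (u * v) ^ a₂ * u ^ a₃ * v ^ a₄) ∎
    where
    open ≡-Reasoning
    regroup : ∀ K a b c e f g → K * (a * b * c) * (e * f * g) ≡ K * ((a * e) * (b * f) * c * g)
    regroup = solve-∀

module BalancedDegrees (s q d : ℕ) where
  x y u v : ℕ
  x = s + q
  y = s + (q + (2 + d))
  u = s + (q + 1)
  v = s + (q + 1 + d)

  xy≤uv : x * y ≤ u * v
  xy≤uv = subst (x * y ≤_) (sym (lemma s q d)) (m≤m+n (x * y) (1 + d))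
    where
    lemma : ∀ s q d → (s + (q + 1)) * (s + (q + 1 + d)) ≡ (s + q) * (s + (q + (2 + d))) + (1 + d)
    lemma = solve-∀

  x≤u : x ≤ u
  x≤u = +-monoʳ-≤ s (m≤m+n q 1)

  x<v : x < v
  x<v = +-monoʳ-< s (≤-trans (≤-reflexive (+-comm 1 q)) (m≤m+n (q + 1) d))

  u>0 : 0 < u
  u>0 = ≤-trans (m≤n+m 1 q) (m≤n+m (q + 1) s)

  v>0 : 0 < v
  v>0 = ≤-<-trans z≤n x<v

Π₁ᶜ-sym : ∀ k s p q → Π₁ᶜ k s p q ≡ Π₁ᶜ k s q p
Π₁ᶜ-sym k s p q = cong₂ _*_ swapped swapped
  where
  swapped : degree-product k s p q ≡ degree-product k s q p
  swapped = sides-sym (k ^ s) ((s + q) ^ p) ((s + p) ^ q)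

Π₂ᶜ-sym : ∀ k s p q → Π₂ᶜ k s p q ≡ Π₂ᶜ k s q p
Π₂ᶜ-sym k s p q = sides-sym ((k ^ k) ^ s) (((s + q) ^ (s + q)) ^ p) (((s + p) ^ (s + p)) ^ q)

-- in an into-K step the moved vertex's old side has degree s + q < k
side<size : ∀ s p q → s + q < s + p + q + 1
side<size s p q = subst (suc (s + q) ≤_) (lemma s p q) (m≤m+n (suc (s + q)) p)
  where
  lemma : ∀ s p q → 1 + (s + q) + p ≡ s + p + q + 1
  lemma = solve-∀

other-side : ∀ s p → 1 + s + (1 + p) ≡ s + (2 + p)
other-side s p = sym (+-suc s (suc p))

other-side≥1 : ∀ s p → 1 ≤ s + (2 + p)
other-side≥1 s p = ≤-trans (s≤s z≤n) (m≤n+m (2 + p) s)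

degree-product-into-K : ∀ s p q → let k = s + p + q + 1 in
  degree-product k s (2 + p) q < degree-product k (1 + s) (1 + p) q
degree-product-into-K s p q =
  subst (λ z → degree-product k s (2 + p) q < k ^ (1 + s) * (1 + s + q) ^ (1 + p) * z ^ q) (sym (other-side s p))
    (exchange-< k (s + q) (1 + s + q) (s + (2 + p)) s p q (side<size s p q) (n≤1+n (s + q)) (s≤s z≤n) (other-side≥1 s p))
  where
  k : ℕ
  k = s + p + q + 1

Π₁ᶜ-into-K : ∀ s p q → let k = s + p + q + 1 in Π₁ᶜ k s (2 + p) q < Π₁ᶜ k (1 + s) (1 + p) q
Π₁ᶜ-into-K s p q = *-mono-< (degree-product-into-K s p q) (degree-product-into-K s p q)

Π₂ᶜ-into-K : ∀ s p q → let k = s + p + q + 1 in 2 ≤ k → Π₂ᶜ k s (2 + p) q < Π₂ᶜ k (1 + s) (1 + p) q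
Π₂ᶜ-into-K s p q k≥2 =
  subst (λ z → Π₂ᶜ k s (2 + p) q < (k ^ k) ^ (1 + s) * ((1 + s + q) ^ (1 + s + q)) ^ (1 + p) * (z ^ z) ^ q)
    (sym (other-side s p))
    (exchange-< (k ^ k) ((s + q) ^ (s + q)) ((1 + s + q) ^ (1 + s + q)) ((s + (2 + p)) ^ (s + (2 + p))) s p q
      (self-power-< (side<size s p q) k≥2) (self-power-mono (n≤1+n (s + q)))
      (self-power≥1 (1 + s + q)) (self-power≥1 (s + (2 + p))))
  where
  k : ℕ
  k = s + p + q + 1

degree-product-balance : ∀ s q d → let k = s + q + q + d + 1 in
  degree-product k s (q + (2 + d)) q < degree-product k s (q + 1 + d) (q + 1)
degree-product-balance s q d =
  subst₂ _<_ (cong₂ (λ e f → k ^ s * x ^ e * y ^ f) (e₁ q d) (+-identityʳ q))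
             (cong₂ (λ e f → k ^ s * u ^ e * v ^ f) (e₂ q d) (cong (_+ 1) (+-identityʳ q)))
    (balance-< (k ^ s) x y u v q 0 (1 + d) 1 q (^-pos s k>0) xy≤uv x≤u x<v u>0 v>0 ≤-refl ≤-refl)
  where
  open BalancedDegrees s q d
  k : ℕ
  k = s + q + q + d + 1
  k>0 : 0 < k
  k>0 = subst (0 <_) (+-comm 1 (s + q + q + d)) (s≤s z≤n)
  e₁ : ∀ q d → q + 0 + (1 + d) + 1 ≡ q + (2 + d)
  e₁ = solve-∀
  e₂ : ∀ q d → q + 0 + (1 + d) ≡ q + 1 + d
  e₂ = solve-∀

Π₁ᶜ-balance : ∀ s q d → let k = s + q + q + d + 1 in
  Π₁ᶜ k s (q + (2 + d)) q < Π₁ᶜ k s (q + 1 + d) (q + 1)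
Π₁ᶜ-balance s q d = *-mono-< (degree-product-balance s q d) (degree-product-balance s q d)

Π₂ᶜ-balance : ∀ s q d → 1 ≤ s → let k = s + q + q + d + 1 in
  Π₂ᶜ k s (q + (2 + d)) q < Π₂ᶜ k s (q + 1 + d) (q + 1)
Π₂ᶜ-balance s q d s≥1 = subst₂ _<_ (sym before) (sym after)
  (balance-< ((k ^ k) ^ s) x y u v (q * (q + (2 + d))) (s * q) (s * (1 + d)) s ((q + 1 + d) * (q + 1))
    (^-pos s (self-power≥1 k)) xy≤uv x≤u x<v u>0 v>0
    (subst (q * (q + (2 + d)) ≤_) (sym (e-B q d)) (m≤m+n _ _)) s≥1)
  where
  open BalancedDegrees s q d
  k : ℕ
  k = s + q + q + d + 1
  e-B : ∀ q d → (q + 1 + d) * (q + 1) ≡ q * (q + (2 + d)) + (1 + d)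
  e-B = solve-∀
  e-x : ∀ s q d → (s + q) * (q + (2 + d)) ≡ q * (q + (2 + d)) + s * q + s * (1 + d) + s
  e-x = solve-∀
  e-y : ∀ s q d → (s + (q + (2 + d))) * q ≡ q * (q + (2 + d)) + s * q
  e-y = solve-∀
  e-u : ∀ s q d → (s + (q + 1)) * (q + 1 + d) ≡ (q + 1 + d) * (q + 1) + s * q + s * (1 + d)
  e-u = solve-∀
  e-v : ∀ s q d → (s + (q + 1 + d)) * (q + 1) ≡ (q + 1 + d) * (q + 1) + s * q + s
  e-v = solve-∀
  before : Π₂ᶜ k s (q + (2 + d)) q
         ≡ (k ^ k) ^ s * x ^ (q * (q + (2 + d)) + s * q + s * (1 + d) + s) * y ^ (q * (q + (2 + d)) + s * q)
  before = cong₂ (λ z w → (k ^ k) ^ s * z * w) (trans (^-*-assoc x x (q + (2 + d))) (cong (x ^_) (e-x s q d)))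
                                              (trans (^-*-assoc y y q) (cong (y ^_) (e-y s q d)))
  after : Π₂ᶜ k s (q + 1 + d) (q + 1)
        ≡ (k ^ k) ^ s * u ^ ((q + 1 + d) * (q + 1) + s * q + s * (1 + d)) * v ^ ((q + 1 + d) * (q + 1) + s * q + s)
  after = cong₂ (λ z w → (k ^ k) ^ s * z * w) (trans (^-*-assoc u u (q + 1 + d)) (cong (u ^_) (e-u s q d)))
                                             (trans (^-*-assoc v v (q + 1)) (cong (v ^_) (e-v s q d)))

-- The extremal bound for one index
--
-- Here n = k + 1 = m + 2b + r, m = t + 1, r ≤ 1.

size≥2 : ∀ t k → suc t + 2 ≤ suc k → 2 ≤ k
size≥2 t k m+2≤n = ≤-pred (≤-trans (+-monoʳ-≤ 2 (s≤s z≤n)) (subst (_≤ suc k) (+-comm (suc t) 2) m+2≤n))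

record ExtremalAt {n} (G : Graph n) (m a x bound : ℕ) : Set where
  constructor extremal
  field
    at-most : x ≤ bound
    equality : x ≡ bound ⇔ IsoTo G (joinAdj m a)

module ExtremalBound
  (I : ∀ {n} → Graph n → ℕ)
  (Φ : ℕ → ℕ → ℕ → ℕ → ℕ)
  (I-class : ∀ {k} (κ : Fin (suc k) → Cls) → I (classGraph κ) ≡ Φ k (cnt κ Kc) (cnt κ Ac) (cnt κ Bc))
  (I-mono : ∀ {n} (G H : Graph n) → G ⊆ᴳ H → I G ≤ I H)
  (I-rigid : ∀ {n} (G H : Graph n) → G ⊆ᴳ H → (∀ i → 2 ≤ deg H i) → I G ≡ I H → SameEdges G H)
  (I-iso : ∀ {n} (G H : Graph n) (σ : Fin n ↔ Fin n) →
           (∀ i j → adj G i j ≡ adj H (Inverse.to σ i) (Inverse.to σ j)) → I G ≡ I H)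
  (k t b r : ℕ) (r≤1 : r ≤ 1) (n≡ : suc t + (b + r) + b ≡ suc k) (m+2≤n : suc t + 2 ≤ suc k)
  (Φ-sym : ∀ s p q → Φ k s p q ≡ Φ k s q p)
  (into-K : ∀ s p q → s + (2 + p) + q ≡ suc k → s < suc t → Φ k s (2 + p) q < Φ k (1 + s) (1 + p) q)
  (balance : ∀ q d → suc t + (q + (2 + d)) + q ≡ suc k →
             Φ k (suc t) (q + (2 + d)) q < Φ k (suc t) (q + 1 + d) (q + 1))
  where

  open Maximise (Φ k) (suc k) (suc t) b r r≤1 n≡ m+2≤n Φ-sym into-K balance using (Φ*; optimum; Optimal; Balanced)

  -- both sides of the extremal graph are non-empty, since m + 2 ≤ n
  b≥1 : 1 ≤ b
  b≥1 = positive b n≡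
    where
    positive : ∀ b → suc t + (b + r) + b ≡ suc k → 1 ≤ b
    positive (suc _) _ = s≤s z≤n
    positive zero n≡ = ⊥-elim (<-irrefl refl
      (≤-trans (+-cancelˡ-≤ (suc t) 2 r (subst (suc t + 2 ≤_) (trans (sym n≡) (+-identityʳ (suc t + r))) m+2≤n)) r≤1))

  k≥2 : 2 ≤ k
  k≥2 = size≥2 t k m+2≤n

  bound : (G : Graph (suc k)) → v₂≤ G (suc t) → ExtremalAt G (suc t) (b + r) (I G) Φ*
  bound G (S , |S|≤m , side , proper) = extremal I≤Φ* (mk⇔ extremal⇒join join⇒extremal)
    where
    κ : Fin (suc k) → Cls
    κ = classOf S side
    H : Graph (suc k)
    H = classGraph κ
    open ClassGraph κ using (s; p; q)
    G⊆H : G ⊆ᴳ H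
    G⊆H = BipartiteAfterDeletion.⊆classGraph G S side proper
    optimal : Optimal s p q
    optimal = optimum s p q (subst (_≤ suc t) (cnt-classOf S side) |S|≤m) (cnt-total κ)

    I≤Φ* : I G ≤ Φ*
    I≤Φ* = ≤-trans (I-mono G H G⊆H) (subst (_≤ Φ*) (sym (I-class κ)) (proj₁ optimal))

    extremal⇒join : I G ≡ Φ* → IsoTo G (joinAdj (suc t) (b + r))
    extremal⇒join e = proj₁ H≅join , λ i j → trans (same i j) (proj₂ H≅join i j)
      where
      Φ≡Φ* : Φ k s p q ≡ Φ*
      Φ≡Φ* = ≤-antisym (proj₁ optimal) (subst (Φ* ≤_) (I-class κ) (subst (_≤ I H) e (I-mono G H G⊆H)))
      s≡m : s ≡ suc t
      s≡m = proj₁ (proj₂ optimal Φ≡Φ*)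
      sides : Balanced p q
      sides = proj₂ (proj₂ optimal Φ≡Φ*)
      -- in the optimal class graph every vertex has degree ≥ 2
      p,q≥1 : 1 ≤ p × 1 ≤ q
      p,q≥1 with sides
      ... | inj₁ (p≡ , q≡) = subst (1 ≤_) (sym p≡) (≤-trans b≥1 (m≤m+n b r)) , subst (1 ≤_) (sym q≡) b≥1
      ... | inj₂ (p≡ , q≡) = subst (1 ≤_) (sym p≡) b≥1 , subst (1 ≤_) (sym q≡) (≤-trans b≥1 (m≤m+n b r))
      s≥1 : 1 ≤ s
      s≥1 = subst (1 ≤_) (sym s≡m) (s≤s z≤n)
      mindeg≥2 : ∀ i → 2 ≤ deg H i
      mindeg≥2 i = subst (2 ≤_) (sym (ClassGraph.degH κ i)) (by-class (κ i))
        where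
        by-class : ∀ c → 2 ≤ DegreePolynomials.degree _+_ _*_ k s (s ∸ 1) p q c
        by-class Kc = k≥2
        by-class Ac = +-mono-≤ s≥1 (proj₂ p,q≥1)
        by-class Bc = +-mono-≤ s≥1 (proj₁ p,q≥1)
      same : SameEdges G H
      same = I-rigid G H G⊆H mindeg≥2 (trans e (trans (sym Φ≡Φ*) (sym (I-class κ))))
      H≅join : IsoTo H (joinAdj (suc t) (b + r))
      H≅join = class-graph≅join κ (suc t) (b + r) b n≡ s≡m sides

    join⇒extremal : IsoTo G (joinAdj (suc t) (b + r)) → I G ≡ Φ*
    join⇒extremal (σ , preserves) =
      trans (I-iso G join-graph σ preserves′)
            (trans (I-class (joinClasses (suc t) (b + r))) (at-sizes (joinClasses-counts (suc k) (suc t) (b + r) b n≡)))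
      where
      join-graph : Graph (suc k)
      join-graph = classGraph {suc k} (joinClasses (suc t) (b + r))
      preserves′ : ∀ i j → adj G i j ≡ adj join-graph (Inverse.to σ i) (Inverse.to σ j)
      preserves′ i j = trans (preserves i j) (joinAdj≡classAdj (suc t) (b + r) (Inverse.to σ i) (Inverse.to σ j))
      at-sizes : ∀ {x y z} → x ≡ suc t × y ≡ b + r × z ≡ b → Φ k x y z ≡ Φ*
      at-sizes (refl , refl , refl) = refl

at-size-into-K : (Φ : ℕ → ℕ → ℕ → ℕ → ℕ) →
  (∀ s p q → let k = s + p + q + 1 in 2 ≤ k → Φ k s (2 + p) q < Φ k (1 + s) (1 + p) q) →
  ∀ {k} → 2 ≤ k → ∀ s p q → s + (2 + p) + q ≡ suc k → Φ k s (2 + p) q < Φ k (1 + s) (1 + p) q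
at-size-into-K Φ step {k} k≥2 s p q h with into-K-size {k} {s} {p} {q} h
... | refl = step s p q k≥2

at-size-balance : (Φ : ℕ → ℕ → ℕ → ℕ → ℕ) (s : ℕ) →
  (∀ q d → let k = s + q + q + d + 1 in Φ k s (q + (2 + d)) q < Φ k s (q + 1 + d) (q + 1)) →
  ∀ {k} q d → s + (q + (2 + d)) + q ≡ suc k → Φ k s (q + (2 + d)) q < Φ k s (q + 1 + d) (q + 1)
at-size-balance Φ s step {k} q d h with balance-size {k} {s} {q} {d} h
... | refl = step q d

module FourBounds (k t b r : ℕ) (r≤1 : r ≤ 1) (n≡ : suc t + (b + r) + b ≡ suc k) (m+2≤n : suc t + 2 ≤ suc k)
  (G : Graph (suc k)) (v₂≤m : v₂≤ G (suc t)) where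

  k≥2 : 2 ≤ k
  k≥2 = size≥2 t k m+2≤n

  M₁-bound : ExtremalAt G (suc t) (b + r) (M₁ G) (M₁ᶜ k (suc t) (b + r) b)
  M₁-bound = ExtremalBound.bound M₁ M₁ᶜ ClassGraph.M₁-class
    (λ G H G⊆H → Spanning.M₁-mono G H G⊆H) (λ G H G⊆H _ → Spanning.M₁-rigid G H G⊆H)
    (λ G H σ e → Isomorphic.M₁-invariant G H σ e)
    k t b r r≤1 n≡ m+2≤n (M₁ᶜ-sym k)
    (λ s p q h _ → at-size-into-K M₁ᶜ (λ s p q _ → M₁ᶜ-into-K s p q) k≥2 s p q h)
    (at-size-balance M₁ᶜ (suc t) (M₁ᶜ-balance (suc t)))
    G v₂≤m

  -- the bound concerns twice the second Zagreb index
  M₂-bound : ExtremalAt G (suc t) (b + r) (2 * M₂ G) (M₂ᶜ k (suc t) (b + r) b)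
  M₂-bound = ExtremalBound.bound (λ G → 2 * M₂ G) M₂ᶜ ClassGraph.M₂-class
    (λ G H G⊆H → *-monoʳ-≤ 2 (Spanning.M₂-mono G H G⊆H))
    (λ G H G⊆H _ e → Spanning.M₂-rigid G H G⊆H (*-cancelˡ-≡ _ _ 2 e))
    (λ G H σ e → cong (2 *_) (Isomorphic.M₂-invariant G H σ e))
    k t b r r≤1 n≡ m+2≤n (M₂ᶜ-sym k)
    (λ s p q h _ → at-size-into-K M₂ᶜ (λ s p q _ → M₂ᶜ-into-K s p q) k≥2 s p q h)
    (at-size-balance M₂ᶜ (suc t) (M₂ᶜ-balance t))
    G v₂≤m

  Π₁-bound : ExtremalAt G (suc t) (b + r) (Π₁ G) (Π₁ᶜ k (suc t) (b + r) b)
  Π₁-bound = ExtremalBound.bound Π₁ Π₁ᶜ ClassGraph.Π₁-class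
    (λ G H G⊆H → Spanning.Π₁-mono G H G⊆H) (λ G H G⊆H mindeg → Spanning.Π₁-rigid G H G⊆H mindeg)
    (λ G H σ e → Isomorphic.Π₁-invariant G H σ e)
    k t b r r≤1 n≡ m+2≤n (Π₁ᶜ-sym k)
    (λ s p q h _ → at-size-into-K Π₁ᶜ (λ s p q _ → Π₁ᶜ-into-K s p q) k≥2 s p q h)
    (at-size-balance Π₁ᶜ (suc t) (Π₁ᶜ-balance (suc t)))
    G v₂≤m

  Π₂-bound : ExtremalAt G (suc t) (b + r) (Π₂ G) (Π₂ᶜ k (suc t) (b + r) b)
  Π₂-bound = ExtremalBound.bound Π₂ Π₂ᶜ ClassGraph.Π₂-class
    (λ G H G⊆H → Spanning.Π₂-mono G H G⊆H) (λ G H G⊆H mindeg → Spanning.Π₂-rigid G H G⊆H mindeg)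
    (λ G H σ e → Isomorphic.Π₂-invariant G H σ e)
    k t b r r≤1 n≡ m+2≤n (Π₂ᶜ-sym k)
    (λ s p q h _ → at-size-into-K Π₂ᶜ Π₂ᶜ-into-K k≥2 s p q h)
    (at-size-balance Π₂ᶜ (suc t) (λ q d → Π₂ᶜ-balance (suc t) q d (s≤s z≤n)))
    G v₂≤m

-- Closed forms of the extremal values
--
-- The class polynomials are evaluated on
-- expressions over ℕ-constants, whose evaluation commutes with the cast
-- +_ : ℕ → ℤ; the integer identity is then a ring-solver goal in t and b.

data Expr : Set where
  con : ℕ → Expr
  _⊕_ _⊗_ : Expr → Expr → Expr

⟦_⟧ℕ : Expr → ℕ
⟦ con x ⟧ℕ = x
⟦ e ⊕ f ⟧ℕ = ⟦ e ⟧ℕ + ⟦ f ⟧ℕ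
⟦ e ⊗ f ⟧ℕ = ⟦ e ⟧ℕ * ⟦ f ⟧ℕ

⟦_⟧ℤ : Expr → ℤ
⟦ con x ⟧ℤ = + x
⟦ e ⊕ f ⟧ℤ = ⟦ e ⟧ℤ ℤ.+ ⟦ f ⟧ℤ
⟦ e ⊗ f ⟧ℤ = ⟦ e ⟧ℤ ℤ.* ⟦ f ⟧ℤ

cast-⟦⟧ : ∀ e → + ⟦ e ⟧ℕ ≡ ⟦ e ⟧ℤ
cast-⟦⟧ (con x) = refl
cast-⟦⟧ (e ⊕ f) = trans (pos-+ ⟦ e ⟧ℕ ⟦ f ⟧ℕ) (cong₂ ℤ._+_ (cast-⟦⟧ e) (cast-⟦⟧ f))
cast-⟦⟧ (e ⊗ f) = trans (pos-* ⟦ e ⟧ℕ ⟦ f ⟧ℕ) (cong₂ ℤ._*_ (cast-⟦⟧ e) (cast-⟦⟧ f))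

module ExtremalExpr (t b r : ℕ) =
  DegreePolynomials _⊕_ _⊗_ ((con t ⊕ (con b ⊕ con r)) ⊕ con b) (con 1 ⊕ con t) (con t) (con b ⊕ con r) (con b)

M₁-even : ∀ {k} t b → suc t + (b + 0) + b ≡ suc k → let n = suc k ; m = suc t in
  (+ 4) ℤ.* (+ m) ℤ.* ((+ n) ℤ.- (+ 1)) ℤ.^ 2
    ℤ.+ ((+ n) ℤ.^ 3 ℤ.+ (+ n) ℤ.^ 2 ℤ.* (+ m) ℤ.- (+ m) ℤ.^ 2 ℤ.* (+ n) ℤ.- (+ m) ℤ.^ 3)
  ≡ + (4 * M₁ᶜ k m (b + 0) b)
M₁-even t b n≡ with suc-injective n≡
... | refl = trans (identity (+ t) (+ b)) (sym (cast-⟦⟧ (con 4 ⊗ ExtremalExpr.sum-of-squares t b 0)))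
  where
  identity : ∀ (T B : ℤ) → let m = + 1 ℤ.+ T ; p = B ℤ.+ + 0 ; k = T ℤ.+ p ℤ.+ B ; n = m ℤ.+ p ℤ.+ B in
      + 4 ℤ.* m ℤ.* ((n ℤ.- + 1) ℤ.* ((n ℤ.- + 1) ℤ.* + 1))
        ℤ.+ (n ℤ.* (n ℤ.* (n ℤ.* + 1)) ℤ.+ n ℤ.* (n ℤ.* + 1) ℤ.* m ℤ.- m ℤ.* (m ℤ.* + 1) ℤ.* n ℤ.- m ℤ.* (m ℤ.* (m ℤ.* + 1)))
    ≡ + 4 ℤ.* (m ℤ.* (k ℤ.* k) ℤ.+ p ℤ.* ((m ℤ.+ B) ℤ.* (m ℤ.+ B)) ℤ.+ B ℤ.* ((m ℤ.+ p) ℤ.* (m ℤ.+ p)))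
  identity = ℤSolver.solve-∀

M₁-odd : ∀ {k} t b → suc t + (b + 1) + b ≡ suc k → let n = suc k ; m = suc t in
  (+ 4) ℤ.* (+ m) ℤ.* ((+ n) ℤ.- (+ 1)) ℤ.^ 2
    ℤ.+ ((+ n) ℤ.^ 3 ℤ.+ (+ n) ℤ.^ 2 ℤ.* (+ m) ℤ.- (+ m) ℤ.^ 2 ℤ.* (+ n) ℤ.- (+ n)
         ℤ.- (+ m) ℤ.^ 3 ℤ.- (+ 3) ℤ.* (+ m))
  ≡ + (4 * M₁ᶜ k m (b + 1) b)
M₁-odd t b n≡ with suc-injective n≡
... | refl = trans (identity (+ t) (+ b)) (sym (cast-⟦⟧ (con 4 ⊗ ExtremalExpr.sum-of-squares t b 1)))
  where
  identity : ∀ (T B : ℤ) → let m = + 1 ℤ.+ T ; p = B ℤ.+ + 1 ; k = T ℤ.+ p ℤ.+ B ; n = m ℤ.+ p ℤ.+ B in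
      + 4 ℤ.* m ℤ.* ((n ℤ.- + 1) ℤ.* ((n ℤ.- + 1) ℤ.* + 1))
        ℤ.+ (n ℤ.* (n ℤ.* (n ℤ.* + 1)) ℤ.+ n ℤ.* (n ℤ.* + 1) ℤ.* m ℤ.- m ℤ.* (m ℤ.* + 1) ℤ.* n ℤ.- n
             ℤ.- m ℤ.* (m ℤ.* (m ℤ.* + 1)) ℤ.- + 3 ℤ.* m)
    ≡ + 4 ℤ.* (m ℤ.* (k ℤ.* k) ℤ.+ p ℤ.* ((m ℤ.+ B) ℤ.* (m ℤ.+ B)) ℤ.+ B ℤ.* ((m ℤ.+ p) ℤ.* (m ℤ.+ p)))
  identity = ℤSolver.solve-∀

M₂-even : ∀ {k} t b → suc t + (b + 0) + b ≡ suc k → let n = suc k ; m = suc t in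
  (+ 8) ℤ.* (+ m) ℤ.* ((+ m) ℤ.- (+ 1)) ℤ.* ((+ n) ℤ.- (+ 1)) ℤ.^ 2
    ℤ.+ ((+ n) ℤ.^ 2 ℤ.- (+ m) ℤ.^ 2)
        ℤ.* ((+ n) ℤ.^ 2 ℤ.+ (+ 8) ℤ.* (+ m) ℤ.* (+ n) ℤ.- (+ m) ℤ.^ 2 ℤ.- (+ 8) ℤ.* (+ m))
  ≡ + (8 * M₂ᶜ k m (b + 0) b)
M₂-even t b n≡ with suc-injective n≡
... | refl = trans (identity (+ t) (+ b)) (sym (cast-⟦⟧ (con 8 ⊗ ExtremalExpr.degree-nbr-sum t b 0)))
  where
  identity : ∀ (T B : ℤ) → let m = + 1 ℤ.+ T ; p = B ℤ.+ + 0 ; k = T ℤ.+ p ℤ.+ B ; n = m ℤ.+ p ℤ.+ B in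
      + 8 ℤ.* m ℤ.* (m ℤ.- + 1) ℤ.* ((n ℤ.- + 1) ℤ.* ((n ℤ.- + 1) ℤ.* + 1))
        ℤ.+ (n ℤ.* (n ℤ.* + 1) ℤ.- m ℤ.* (m ℤ.* + 1))
            ℤ.* (n ℤ.* (n ℤ.* + 1) ℤ.+ + 8 ℤ.* m ℤ.* n ℤ.- m ℤ.* (m ℤ.* + 1) ℤ.- + 8 ℤ.* m)
    ≡ + 8 ℤ.* (m ℤ.* (k ℤ.* (T ℤ.* k ℤ.+ p ℤ.* (m ℤ.+ B) ℤ.+ B ℤ.* (m ℤ.+ p)))
               ℤ.+ p ℤ.* ((m ℤ.+ B) ℤ.* (m ℤ.* k ℤ.+ B ℤ.* (m ℤ.+ p)))
               ℤ.+ B ℤ.* ((m ℤ.+ p) ℤ.* (m ℤ.* k ℤ.+ p ℤ.* (m ℤ.+ B))))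
  identity = ℤSolver.solve-∀

M₂-odd : ∀ {k} t b → suc t + (b + 1) + b ≡ suc k → let n = suc k ; m = suc t in
  (+ 8) ℤ.* (+ m) ℤ.* ((+ m) ℤ.- (+ 1)) ℤ.* ((+ n) ℤ.- (+ 1)) ℤ.^ 2
    ℤ.+ (((+ n) ℤ.+ (+ m)) ℤ.^ 2 ℤ.- (+ 1)) ℤ.* (((+ n) ℤ.- (+ m)) ℤ.^ 2 ℤ.- (+ 1))
    ℤ.+ (+ 4) ℤ.* (+ m) ℤ.* ((+ n) ℤ.- (+ 1))
        ℤ.* ((+ 2) ℤ.* (+ n) ℤ.^ 2 ℤ.- (+ 2) ℤ.* (+ m) ℤ.^ 2 ℤ.- (+ 2))
  ≡ + (8 * M₂ᶜ k m (b + 1) b)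
M₂-odd t b n≡ with suc-injective n≡
... | refl = trans (identity (+ t) (+ b)) (sym (cast-⟦⟧ (con 8 ⊗ ExtremalExpr.degree-nbr-sum t b 1)))
  where
  identity : ∀ (T B : ℤ) → let m = + 1 ℤ.+ T ; p = B ℤ.+ + 1 ; k = T ℤ.+ p ℤ.+ B ; n = m ℤ.+ p ℤ.+ B in
      + 8 ℤ.* m ℤ.* (m ℤ.- + 1) ℤ.* ((n ℤ.- + 1) ℤ.* ((n ℤ.- + 1) ℤ.* + 1))
        ℤ.+ ((n ℤ.+ m) ℤ.* ((n ℤ.+ m) ℤ.* + 1) ℤ.- + 1) ℤ.* ((n ℤ.- m) ℤ.* ((n ℤ.- m) ℤ.* + 1) ℤ.- + 1)
        ℤ.+ + 4 ℤ.* m ℤ.* (n ℤ.- + 1)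
            ℤ.* (+ 2 ℤ.* (n ℤ.* (n ℤ.* + 1)) ℤ.- + 2 ℤ.* (m ℤ.* (m ℤ.* + 1)) ℤ.- + 2)
    ≡ + 8 ℤ.* (m ℤ.* (k ℤ.* (T ℤ.* k ℤ.+ p ℤ.* (m ℤ.+ B) ℤ.+ B ℤ.* (m ℤ.+ p)))
               ℤ.+ p ℤ.* ((m ℤ.+ B) ℤ.* (m ℤ.* k ℤ.+ B ℤ.* (m ℤ.+ p)))
               ℤ.+ B ℤ.* ((m ℤ.+ p) ℤ.* (m ℤ.* k ℤ.+ p ℤ.* (m ℤ.+ B))))
  identity = ℤSolver.solve-∀

half : ∀ {x} y → x ≡ y * 2 → x / 2 ≡ y
half y refl = m*n/n≡m y 2

quarter : ∀ {x} y → x ≡ y * 4 → x / 4 ≡ y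
quarter y refl = m*n/n≡m y 4

^-double : ∀ x e → x ^ (2 * e) ≡ x ^ e * x ^ e
^-double x e = trans (cong (x ^_) (lemma e)) (^-distribˡ-+-* x e e)
  where
  lemma : ∀ e → 2 * e ≡ e + e
  lemma = solve-∀

Π₁-even : ∀ {k} t b → suc t + (b + 0) + b ≡ suc k → let n = suc k ; m = suc t in
  (n ∸ 1) ^ (2 * m) * ((n + m) / 2) ^ (2 * (n ∸ m)) ≡ Π₁ᶜ k m (b + 0) b
Π₁-even t b n≡ with suc-injective n≡
... | refl = begin
  k ^ (2 * suc t) * ((suc k + suc t) / 2) ^ (2 * (k ∸ t))
    ≡⟨ cong₂ (λ u v → k ^ (2 * suc t) * u ^ (2 * v)) (half x (lemma t b))
             (trans (cong (_∸ t) (+-assoc t (b + 0) b)) (m+n∸m≡n t (b + 0 + b))) ⟩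
  k ^ (2 * suc t) * x ^ (2 * (b + 0 + b))
    ≡⟨ cong₂ _*_ (^-double k (suc t))
             (trans (^-double x (b + 0 + b)) (cong₂ _*_ (^-distribˡ-+-* x (b + 0) b) (^-distribˡ-+-* x (b + 0) b))) ⟩
  k ^ suc t * k ^ suc t * (x ^ (b + 0) * x ^ b * (x ^ (b + 0) * x ^ b))
    ≡⟨ regroup (k ^ suc t) (x ^ (b + 0)) (x ^ b) ⟩
  (k ^ suc t * x ^ (b + 0) * x ^ b) * (k ^ suc t * x ^ (b + 0) * x ^ b)
    ≡⟨ cong (λ z → (k ^ suc t * x ^ (b + 0) * z) * (k ^ suc t * x ^ (b + 0) * z))
            (cong (λ w → (suc t + w) ^ b) (sym (+-identityʳ b))) ⟩
  Π₁ᶜ k (suc t) (b + 0) b ∎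
  where
  open ≡-Reasoning
  k : ℕ
  k = t + (b + 0) + b
  x : ℕ
  x = suc t + b
  lemma : ∀ t b → suc (t + (b + 0) + b) + suc t ≡ (suc t + b) * 2
  lemma = solve-∀
  regroup : ∀ X Y Z → X * X * (Y * Z * (Y * Z)) ≡ (X * Y * Z) * (X * Y * Z)
  regroup = solve-∀

Π₁-odd : ∀ {k} t b → suc t + (b + 1) + b ≡ suc k → let n = suc k ; m = suc t in
  (n ∸ 1) ^ (2 * m) * ((n + m + 1) / 2) ^ (n ∸ m ∸ 1) * ((n + m ∸ 1) / 2) ^ (n ∸ m + 1) ≡ Π₁ᶜ k m (b + 1) b
Π₁-odd t b n≡ with suc-injective n≡
... | refl = begin
  k ^ (2 * suc t) * ((suc k + suc t + 1) / 2) ^ (k ∸ t ∸ 1) * ((k + suc t) / 2) ^ (k ∸ t + 1)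
    ≡⟨ cong₂ (λ u v → k ^ (2 * suc t) * u ^ (v ∸ 1) * ((k + suc t) / 2) ^ (v + 1)) (half y (l₁ t b)) k∸t ⟩
  k ^ (2 * suc t) * y ^ (b + 1 + b ∸ 1) * ((k + suc t) / 2) ^ (b + 1 + b + 1)
    ≡⟨ cong₃ (cong (_∸ 1) (l₃ b)) (half x (l₂ t b)) (l₄ b) ⟩
  k ^ (2 * suc t) * y ^ (b + b) * x ^ ((b + 1) + (b + 1))
    ≡⟨ cong₂ _*_ (cong₂ _*_ (^-double k (suc t)) (^-distribˡ-+-* y b b)) (^-distribˡ-+-* x (b + 1) (b + 1)) ⟩
  k ^ suc t * k ^ suc t * (y ^ b * y ^ b) * (x ^ (b + 1) * x ^ (b + 1))
    ≡⟨ regroup (k ^ suc t) (x ^ (b + 1)) (y ^ b) ⟩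
  Π₁ᶜ k (suc t) (b + 1) b ∎
  where
  open ≡-Reasoning
  k : ℕ
  k = t + (b + 1) + b
  x : ℕ
  x = suc t + b
  y : ℕ
  y = suc t + (b + 1)
  k∸t : k ∸ t ≡ b + 1 + b
  k∸t = trans (cong (_∸ t) (+-assoc t (b + 1) b)) (m+n∸m≡n t (b + 1 + b))
  l₁ : ∀ t b → suc (t + (b + 1) + b) + suc t + 1 ≡ (suc t + (b + 1)) * 2
  l₁ = solve-∀
  l₂ : ∀ t b → t + (b + 1) + b + suc t ≡ (suc t + b) * 2
  l₂ = solve-∀
  l₃ : ∀ b → b + 1 + b ≡ suc (b + b)
  l₃ = solve-∀
  l₄ : ∀ b → b + 1 + b + 1 ≡ (b + 1) + (b + 1)
  l₄ = solve-∀
  regroup : ∀ X Y Z → X * X * (Z * Z) * (Y * Y) ≡ (X * Y * Z) * (X * Y * Z)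
  regroup = solve-∀
  cong₃ : ∀ {e₁ e₁' u u' e₂ e₂'} → e₁ ≡ e₁' → u ≡ u' → e₂ ≡ e₂' →
    k ^ (2 * suc t) * y ^ e₁ * u ^ e₂ ≡ k ^ (2 * suc t) * y ^ e₁' * u' ^ e₂'
  cong₃ refl refl refl = refl

Π₂-even : ∀ {k} t b → suc t + (b + 0) + b ≡ suc k → let n = suc k ; m = suc t in
  (n ∸ 1) ^ (m * (n ∸ 1)) * ((n + m) / 2) ^ ((n ^ 2 ∸ m ^ 2) / 2) ≡ Π₂ᶜ k m (b + 0) b
Π₂-even t b n≡ with suc-injective n≡
... | refl = begin
  k ^ (suc t * k) * ((suc k + suc t) / 2) ^ ((suc k ^ 2 ∸ suc t ^ 2) / 2)
    ≡⟨ cong₂ (λ u v → k ^ (suc t * k) * u ^ v) (half x (l₁ t b))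
             (half E (trans (cong (_∸ suc t ^ 2) (l₂ t b)) (m+n∸m≡n (suc t ^ 2) (E * 2)))) ⟩
  k ^ (suc t * k) * x ^ E
    ≡⟨ cong₂ _*_ (trans (cong (k ^_) (*-comm (suc t) k)) (sym (^-*-assoc k k (suc t))))
                 (trans (^-distribˡ-+-* x (x * (b + 0)) (x * b)) (cong₂ _*_ (sym (^-*-assoc x x (b + 0))) (sym (^-*-assoc x x b)))) ⟩
  (k ^ k) ^ suc t * ((x ^ x) ^ (b + 0) * (x ^ x) ^ b)
    ≡⟨ sym (*-assoc ((k ^ k) ^ suc t) _ _) ⟩
  (k ^ k) ^ suc t * (x ^ x) ^ (b + 0) * (x ^ x) ^ b
    ≡⟨ cong (λ w → (k ^ k) ^ suc t * (x ^ x) ^ (b + 0) * ((suc t + w) ^ (suc t + w)) ^ b) (sym (+-identityʳ b)) ⟩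
  Π₂ᶜ k (suc t) (b + 0) b ∎
  where
  open ≡-Reasoning
  k : ℕ
  k = t + (b + 0) + b
  x : ℕ
  x = suc t + b
  E : ℕ
  E = x * (b + 0) + x * b
  l₁ : ∀ t b → suc (t + (b + 0) + b) + suc t ≡ (suc t + b) * 2
  l₁ = solve-∀
  l₂ : ∀ t b → suc (t + (b + 0) + b) * (suc (t + (b + 0) + b) * 1)
             ≡ suc t * (suc t * 1) + ((suc t + b) * (b + 0) + (suc t + b) * b) * 2
  l₂ = solve-∀

Π₂-odd : ∀ {k} t b → suc t + (b + 1) + b ≡ suc k → let n = suc k ; m = suc t in
  (n ∸ 1) ^ (m * (n ∸ 1)) * ((n + m ∸ 1) / 2) ^ ((n ^ 2 ∸ m ^ 2 + 2 * m ∸ 1) / 4)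
    * ((n + m + 1) / 2) ^ ((n ^ 2 ∸ m ^ 2 ∸ 2 * m ∸ 1) / 4)
  ≡ Π₂ᶜ k m (b + 1) b
Π₂-odd t b n≡ with suc-injective n≡
... | refl = begin
  k ^ (suc t * k) * ((k + suc t) / 2) ^ ((suc k ^ 2 ∸ suc t ^ 2 + 2 * suc t ∸ 1) / 4)
    * ((suc k + suc t + 1) / 2) ^ ((suc k ^ 2 ∸ suc t ^ 2 ∸ 2 * suc t ∸ 1) / 4)
    ≡⟨ cong₄ (half x (l₁ t b)) (quarter (x * (b + 1)) e₁) (half y (l₃ t b)) (quarter (y * b) e₂) ⟩
  k ^ (suc t * k) * x ^ (x * (b + 1)) * y ^ (y * b)
    ≡⟨ cong₃ (trans (cong (k ^_) (*-comm (suc t) k)) (sym (^-*-assoc k k (suc t))))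
             (sym (^-*-assoc x x (b + 1))) (sym (^-*-assoc y y b)) ⟩
  Π₂ᶜ k (suc t) (b + 1) b ∎
  where
  open ≡-Reasoning
  k : ℕ
  k = t + (b + 1) + b
  x : ℕ
  x = suc t + b
  y : ℕ
  y = suc t + (b + 1)
  W : ℕ
  W = (b + 1 + b) * (suc t + suc t + b + b + 1)
  l₁ : ∀ t b → t + (b + 1) + b + suc t ≡ (suc t + b) * 2
  l₁ = solve-∀
  l₃ : ∀ t b → suc (t + (b + 1) + b) + suc t + 1 ≡ (suc t + (b + 1)) * 2
  l₃ = solve-∀
  l₂ : ∀ t b → suc (t + (b + 1) + b) * (suc (t + (b + 1) + b) * 1)
             ≡ suc t * (suc t * 1) + (b + 1 + b) * (suc t + suc t + b + b + 1)
  l₂ = solve-∀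
  lW₁ : ∀ t b → (b + 1 + b) * (suc t + suc t + b + b + 1) + 2 * suc t ≡ suc ((suc t + b) * (b + 1) * 4)
  lW₁ = solve-∀
  lW₂ : ∀ t b → (b + 1 + b) * (suc t + suc t + b + b + 1) ≡ 2 * suc t + suc ((suc t + (b + 1)) * b * 4)
  lW₂ = solve-∀
  n²∸m² : suc k ^ 2 ∸ suc t ^ 2 ≡ W
  n²∸m² = trans (cong (_∸ suc t ^ 2) (l₂ t b)) (m+n∸m≡n (suc t ^ 2) W)
  e₁ : suc k ^ 2 ∸ suc t ^ 2 + 2 * suc t ∸ 1 ≡ x * (b + 1) * 4
  e₁ = cong (_∸ 1) (trans (cong (_+ 2 * suc t) n²∸m²) (lW₁ t b))
  e₂ : suc k ^ 2 ∸ suc t ^ 2 ∸ 2 * suc t ∸ 1 ≡ y * b * 4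
  e₂ = cong (_∸ 1) (trans (cong (_∸ 2 * suc t) (trans n²∸m² (lW₂ t b))) (m+n∸m≡n (2 * suc t) (suc (y * b * 4))))
  cong₄ : ∀ {u u' e e' v v' f f'} → u ≡ u' → e ≡ e' → v ≡ v' → f ≡ f' →
    k ^ (suc t * k) * u ^ e * v ^ f ≡ k ^ (suc t * k) * u' ^ e' * v' ^ f'
  cong₄ refl refl refl refl = refl
  cong₃ : ∀ {a a' c c' d d'} → a ≡ a' → c ≡ c' → d ≡ d' → a * c * d ≡ a' * c' * d'
  cong₃ refl refl refl = refl

restate : ∀ {n} {G : Graph n} {m a a' x V F} → a ≡ a' → F ≡ V →
  ExtremalAt G m a x V → (x ≤ F) × (x ≡ F ⇔ IsoTo G (joinAdj m a'))
restate refl refl (extremal x≤V x≡V⇔iso) = x≤V , x≡V⇔iso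

restateℤ : ∀ {n} {G : Graph n} {m a a' x V y} c .{{_ : NonZero c}} {F : ℤ} → y ≡ c * x → a ≡ a' →
  F ≡ + (c * V) → ExtremalAt G m a x V → (+ y ℤ.≤ F) × (+ y ≡ F ⇔ IsoTo G (joinAdj m a'))
restateℤ c refl refl refl (extremal x≤V x≡V⇔iso) =
  ℤ.+≤+ (*-monoʳ-≤ c x≤V) ,
  mk⇔ (λ e → Equivalence.to x≡V⇔iso (*-cancelˡ-≡ _ _ c (+-injective e)))
      (λ iso → cong (λ z → + (c * z)) (Equivalence.from x≡V⇔iso iso))

infixr 4 _▸_
_▸_ : ∀ {A B C : Set} → A × B → C → A × B × C
(a , b) ▸ c = a , b , c

parity-split : ∀ n m r → m ≤ n → (n ∸ m) % 2 ≡ r → m + ((n ∸ m) / 2 + r) + (n ∸ m) / 2 ≡ n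
parity-split n m r m≤n parity = begin
  m + (b + r) + b ≡⟨ lemma m b r ⟩
  m + (r + b * 2) ≡⟨ cong (_+_ m) (sym (trans (m≡m%n+[m/n]*n (n ∸ m) 2) (cong (_+ b * 2) parity))) ⟩
  m + (n ∸ m)     ≡⟨ m+[n∸m]≡n m≤n ⟩
  n               ∎
  where
  open ≡-Reasoning
  b : ℕ
  b = (n ∸ m) / 2
  lemma : ∀ m b r → m + (b + r) + b ≡ m + (r + b * 2)
  lemma = solve-∀

odd-half : ∀ x → x % 2 ≡ 1 → x / 2 + 1 ≡ (x + 1) / 2
odd-half x odd = sym (half (x / 2 + 1) (trans (cong (_+ 1) x≡) (lemma (x / 2))))
  where
  x≡ : x ≡ 1 + x / 2 * 2
  x≡ = trans (m≡m%n+[m/n]*n x 2) (cong (_+ x / 2 * 2) odd)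
  lemma : ∀ b → 1 + b * 2 + 1 ≡ (b + 1) * 2
  lemma = solve-∀

2≰0 : ¬ (2 ≤ 0)
2≰0 ()

corollary4p7 :
  (n m : ℕ) → 1 ≤ m → m + 2 ≤ n → (G : Graph n) → v₂≤ G m →
  -- (1) n - m even; extremal graph K_m ∨ (K̄_{(n-m)/2} ∨ K̄_{(n-m)/2})
  (((n ∸ m) % 2 ≡ 0) →
    (+ (4 * M₁ G) ℤ.≤ (+ 4) ℤ.* (+ m) ℤ.* ((+ n) ℤ.- (+ 1)) ℤ.^ 2
        ℤ.+ ((+ n) ℤ.^ 3 ℤ.+ (+ n) ℤ.^ 2 ℤ.* (+ m) ℤ.- (+ m) ℤ.^ 2 ℤ.* (+ n) ℤ.- (+ m) ℤ.^ 3))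
    × ((+ (4 * M₁ G) ≡ (+ 4) ℤ.* (+ m) ℤ.* ((+ n) ℤ.- (+ 1)) ℤ.^ 2
        ℤ.+ ((+ n) ℤ.^ 3 ℤ.+ (+ n) ℤ.^ 2 ℤ.* (+ m) ℤ.- (+ m) ℤ.^ 2 ℤ.* (+ n) ℤ.- (+ m) ℤ.^ 3))
       ⇔ IsoTo G (joinAdj m ((n ∸ m) / 2)))
    × (+ (16 * M₂ G) ℤ.≤ (+ 8) ℤ.* (+ m) ℤ.* ((+ m) ℤ.- (+ 1)) ℤ.* ((+ n) ℤ.- (+ 1)) ℤ.^ 2
        ℤ.+ ((+ n) ℤ.^ 2 ℤ.- (+ m) ℤ.^ 2)
            ℤ.* ((+ n) ℤ.^ 2 ℤ.+ (+ 8) ℤ.* (+ m) ℤ.* (+ n) ℤ.- (+ m) ℤ.^ 2 ℤ.- (+ 8) ℤ.* (+ m)))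
    × ((+ (16 * M₂ G) ≡ (+ 8) ℤ.* (+ m) ℤ.* ((+ m) ℤ.- (+ 1)) ℤ.* ((+ n) ℤ.- (+ 1)) ℤ.^ 2
        ℤ.+ ((+ n) ℤ.^ 2 ℤ.- (+ m) ℤ.^ 2)
            ℤ.* ((+ n) ℤ.^ 2 ℤ.+ (+ 8) ℤ.* (+ m) ℤ.* (+ n) ℤ.- (+ m) ℤ.^ 2 ℤ.- (+ 8) ℤ.* (+ m)))
       ⇔ IsoTo G (joinAdj m ((n ∸ m) / 2)))
    × (Π₁ G ≤ (n ∸ 1) ^ (2 * m) * ((n + m) / 2) ^ (2 * (n ∸ m)))
    × ((Π₁ G ≡ (n ∸ 1) ^ (2 * m) * ((n + m) / 2) ^ (2 * (n ∸ m)))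
       ⇔ IsoTo G (joinAdj m ((n ∸ m) / 2)))
    × (Π₂ G ≤ (n ∸ 1) ^ (m * (n ∸ 1)) * ((n + m) / 2) ^ ((n ^ 2 ∸ m ^ 2) / 2))
    × ((Π₂ G ≡ (n ∸ 1) ^ (m * (n ∸ 1)) * ((n + m) / 2) ^ ((n ^ 2 ∸ m ^ 2) / 2))
       ⇔ IsoTo G (joinAdj m ((n ∸ m) / 2))))
  ×
  -- (2) n - m odd; extremal graph K_m ∨ (K̄_{(n-m+1)/2} ∨ K̄_{(n-m-1)/2})
  (((n ∸ m) % 2 ≡ 1) →
    (+ (4 * M₁ G) ℤ.≤ (+ 4) ℤ.* (+ m) ℤ.* ((+ n) ℤ.- (+ 1)) ℤ.^ 2
        ℤ.+ ((+ n) ℤ.^ 3 ℤ.+ (+ n) ℤ.^ 2 ℤ.* (+ m) ℤ.- (+ m) ℤ.^ 2 ℤ.* (+ n) ℤ.- (+ n)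
             ℤ.- (+ m) ℤ.^ 3 ℤ.- (+ 3) ℤ.* (+ m)))
    × ((+ (4 * M₁ G) ≡ (+ 4) ℤ.* (+ m) ℤ.* ((+ n) ℤ.- (+ 1)) ℤ.^ 2
        ℤ.+ ((+ n) ℤ.^ 3 ℤ.+ (+ n) ℤ.^ 2 ℤ.* (+ m) ℤ.- (+ m) ℤ.^ 2 ℤ.* (+ n) ℤ.- (+ n)
             ℤ.- (+ m) ℤ.^ 3 ℤ.- (+ 3) ℤ.* (+ m)))
       ⇔ IsoTo G (joinAdj m ((n ∸ m + 1) / 2)))
    × (+ (16 * M₂ G) ℤ.≤ (+ 8) ℤ.* (+ m) ℤ.* ((+ m) ℤ.- (+ 1)) ℤ.* ((+ n) ℤ.- (+ 1)) ℤ.^ 2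
        ℤ.+ (((+ n) ℤ.+ (+ m)) ℤ.^ 2 ℤ.- (+ 1)) ℤ.* (((+ n) ℤ.- (+ m)) ℤ.^ 2 ℤ.- (+ 1))
        ℤ.+ (+ 4) ℤ.* (+ m) ℤ.* ((+ n) ℤ.- (+ 1))
            ℤ.* ((+ 2) ℤ.* (+ n) ℤ.^ 2 ℤ.- (+ 2) ℤ.* (+ m) ℤ.^ 2 ℤ.- (+ 2)))
    × ((+ (16 * M₂ G) ≡ (+ 8) ℤ.* (+ m) ℤ.* ((+ m) ℤ.- (+ 1)) ℤ.* ((+ n) ℤ.- (+ 1)) ℤ.^ 2
        ℤ.+ (((+ n) ℤ.+ (+ m)) ℤ.^ 2 ℤ.- (+ 1)) ℤ.* (((+ n) ℤ.- (+ m)) ℤ.^ 2 ℤ.- (+ 1))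
        ℤ.+ (+ 4) ℤ.* (+ m) ℤ.* ((+ n) ℤ.- (+ 1))
            ℤ.* ((+ 2) ℤ.* (+ n) ℤ.^ 2 ℤ.- (+ 2) ℤ.* (+ m) ℤ.^ 2 ℤ.- (+ 2)))
       ⇔ IsoTo G (joinAdj m ((n ∸ m + 1) / 2)))
    × (Π₁ G ≤ (n ∸ 1) ^ (2 * m) * ((n + m + 1) / 2) ^ (n ∸ m ∸ 1)
                * ((n + m ∸ 1) / 2) ^ (n ∸ m + 1))
    × ((Π₁ G ≡ (n ∸ 1) ^ (2 * m) * ((n + m + 1) / 2) ^ (n ∸ m ∸ 1)
                * ((n + m ∸ 1) / 2) ^ (n ∸ m + 1))
       ⇔ IsoTo G (joinAdj m ((n ∸ m + 1) / 2)))
    × (Π₂ G ≤ (n ∸ 1) ^ (m * (n ∸ 1))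
                * ((n + m ∸ 1) / 2) ^ ((n ^ 2 ∸ m ^ 2 + 2 * m ∸ 1) / 4)
                * ((n + m + 1) / 2) ^ ((n ^ 2 ∸ m ^ 2 ∸ 2 * m ∸ 1) / 4))
    × ((Π₂ G ≡ (n ∸ 1) ^ (m * (n ∸ 1))
                * ((n + m ∸ 1) / 2) ^ ((n ^ 2 ∸ m ^ 2 + 2 * m ∸ 1) / 4)
                * ((n + m + 1) / 2) ^ ((n ^ 2 ∸ m ^ 2 ∸ 2 * m ∸ 1) / 4))
       ⇔ IsoTo G (joinAdj m ((n ∸ m + 1) / 2))))
corollary4p7 zero m _ m+2≤0 _ _ = ⊥-elim (2≰0 (≤-trans (m≤n+m 2 m) m+2≤0))
corollary4p7 (suc k) zero () _ _ _
corollary4p7 (suc k) (suc t) _ m+2≤n G v₂≤m =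
  (λ even → let n≡ = parity-split (suc k) (suc t) 0 m≤n even
                a≡ = +-identityʳ ((suc k ∸ suc t) / 2)
                open FourBounds k t ((suc k ∸ suc t) / 2) 0 z≤n n≡ m+2≤n G v₂≤m in
       restateℤ 4 refl a≡ (M₁-even t _ n≡) M₁-bound
     ▸ restateℤ 8 (*-assoc 8 2 (M₂ G)) a≡ (M₂-even t _ n≡) M₂-bound
     ▸ restate a≡ (Π₁-even t _ n≡) Π₁-bound
     ▸ restate a≡ (Π₂-even t _ n≡) Π₂-bound) ,
  (λ odd → let n≡ = parity-split (suc k) (suc t) 1 m≤n odd
               a≡ = odd-half (suc k ∸ suc t) odd
               open FourBounds k t ((suc k ∸ suc t) / 2) 1 ≤-refl n≡ m+2≤n G v₂≤m in
       restateℤ 4 refl a≡ (M₁-odd t _ n≡) M₁-bound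
     ▸ restateℤ 8 (*-assoc 8 2 (M₂ G)) a≡ (M₂-odd t _ n≡) M₂-bound
     ▸ restate a≡ (Π₁-odd t _ n≡) Π₁-bound
     ▸ restate a≡ (Π₂-odd t _ n≡) Π₂-bound)
  where
  m≤n : suc t ≤ suc k
  m≤n = ≤-trans (m≤m+n (suc t) 2) m+2≤n
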